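{- Let $n\geq 1$. Let $c_2(n)$ be the number of partitions of $n$ in which one part occurs exactly twice and all other parts occur exactly once. For a partition $\lambda$ of $n$ into odd parts and a part $i$ of $\lambda$ with multiplicity $m_i\ge1$, let $bomm_\lambda(i)=\lfloor\log_2 m_i\rfloor+1$ be the number of binary digits of $m_i$. Let $b_2(n)$ be the difference $$\sum_{\lambda}\ \sum_{i \text{ a distinct part of } \lambda} bomm_\lambda(i)\;-\;\sum_{\mu}\ell(\mu),$$ where the first sum runs over all partitions $\lambda$ of $n$ into odd parts, the second over all partitions $\mu$ of $n$ into distinct parts, and $\ell(\mu)$ is the number of parts of $\mu$. Then $c_2(n)=b_2(n)$.
   Context: A partition of $n$ is a non-increasing sequence of positive integers (its parts) summing to $n$. -}

module Defs where

open import Data.Nat using (ℕ; zero; suc; _+_; _≤_; _≥_; _<_; _≟_; _≤?_; _<?_)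
open import Data.Nat.Logarithm using (⌊log₂_⌋)
open import Data.Nat.Divisibility using (_∣_; _∣?_)
open import Data.List using (List; []; _∷_; length; filter; map; concatMap; upTo; deduplicate)
open import Data.Nat.ListAction using (sum)
open import Data.List.Relation.Unary.All using (All; all?)
open import Data.List.Relation.Unary.AllPairs using (AllPairs; allPairs?)
open import Data.List.Relation.Unary.Linked using (Linked; linked?)
open import Data.Integer using (ℤ; +_; _-_)
open import Data.Product using (_×_; Σ; ∃; _,_)
open import Relation.Nullary using (Dec; ¬_; _×-dec_; ¬?)
open import Relation.Binary.PropositionalEquality using (_≡_)

IsPartition : ℕ → List ℕ → Set
IsPartition n xs = All (λ x → 1 ≤ x) xs × Linked _≥_ xs × sum xs ≡ n

isPartition? : ∀ n xs → Dec (IsPartition n xs)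
isPartition? n xs = all? (1 ≤?_) xs ×-dec linked? (λ a b → b ≤? a) xs ×-dec (sum xs ≟ n)

listsOfLength : ℕ → ℕ → List (List ℕ)
listsOfLength n zero = [] ∷ []
listsOfLength n (suc k) =
  concatMap (λ x → map (x ∷_) (listsOfLength n k)) (map suc (upTo n))

-- All lists of length ≤ n with entries in {1,…,n}: every partition of n is among them.
candidates : ℕ → List (List ℕ)
candidates n = concatMap (listsOfLength n) (upTo (suc n))

partitions : ℕ → List (List ℕ)
partitions n = filter (isPartition? n) (candidates n)

oddPartitions : ℕ → List (List ℕ)
oddPartitions n = filter (all? (λ x → ¬? (2 ∣? x))) (partitions n)

distinctPartitions : ℕ → List (List ℕ)
distinctPartitions n = filter (allPairs? (λ a b → ¬? (a ≟ b))) (partitions n)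

mult : List ℕ → ℕ → ℕ
mult xs i = length (filter (_≟ i) xs)

distinctParts : List ℕ → List ℕ
distinctParts xs = deduplicate _≟_ xs

oneTwiceRestOnce? : (xs : List ℕ) → Dec
  (length (filter (λ i → mult xs i ≟ 2) (distinctParts xs)) ≡ 1 ×
   length (filter (λ i → mult xs i ≟ 1) (distinctParts xs)) + 1 ≡ length (distinctParts xs))
oneTwiceRestOnce? xs = (_ ≟ 1) ×-dec (_ ≟ _)

c₂ : ℕ → ℕ
c₂ n = length (filter oneTwiceRestOnce? (partitions n))

bomm : List ℕ → ℕ → ℕ
bomm xs i = ⌊log₂ mult xs i ⌋ + 1

b₂ : ℕ → ℤ
b₂ n = + sum (map (λ lam → sum (map (bomm lam) (distinctParts lam))) (oddPartitions n))
     - + sum (map length (distinctPartitions n))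

-- Proof idea: compare generating functions, built up by admitting the part sizes 1, 2, …, k one at a
-- time.  A part K of multiplicity m ≥ 1 has bomm = #{e : 2^e ≤ m}, so the bomm total over partitions into
-- odd parts has generating function 𝒪 · ∑_{K odd, e ≥ 0} x^(K 2^e) = 𝒪 · x/(1 - x), as every j ≥ 1 is
-- K 2^e in exactly one way.  On the distinct side, the recurrences for admitting the part K give
-- ℬ + 𝒞 = 𝒟 · (x + x² + ⋯ + x^k), with ℬ the length total and 𝒞 counting c₂; the new terms match by
-- (1 + x) x = x + x².  Euler's theorem 𝒪 = 𝒟 then turns the two products into the same series, up to
-- degree n once all parts ≤ n are admitted.
module Submission where

open import Defs
open import Data.Nat
open import Data.Nat.Properties
open import Data.Nat.Logarithm
  using (⌊log₂_⌋; ⌊log₂⌋-mono-≤; ⌊log₂⌊n/2⌋⌋≡⌊log₂n⌋∸1; ⌊log₂[2*b]⌋≡1+⌊log₂b⌋)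
open import Data.Nat.Divisibility using (_∣_; _∣?_; divides)
open import Data.Nat.Induction using (<-rec)
open import Data.Nat.Solver using (module +-*-Solver)
open import Data.Nat.ListAction using (sum)
open import Data.Nat.ListAction.Properties using (sum-++; sum-↭)
open import Data.List using (List; []; _∷_; _++_; length; filter; map; concatMap; upTo; applyUpTo; replicate)
open import Data.List.Properties
  using ( ++-cancelˡ; ∷-injectiveʳ; filter-++; filter-accept; filter-reject; filter-all; length-++
        ; length-replicate; map-++; map-∘; map-upTo)
open import Data.List.Relation.Unary.All as All using (All; []; _∷_; all?)
open import Data.List.Relation.Unary.All.Properties as AllP using ()
open import Data.List.Relation.Unary.Any using (here; there)
open import Data.List.Relation.Unary.AllPairs using (AllPairs; []; _∷_; allPairs?)
open import Data.List.Relation.Unary.Linked as Linked using (Linked; []; [-]; _∷_)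
open import Data.List.Relation.Unary.Linked.Properties using (Linked⇒All)
open import Data.List.Relation.Unary.Unique.Propositional using (Unique)
open import Data.List.Relation.Unary.Unique.Propositional.Properties as UniqueP using ()
open import Data.List.Relation.Binary.BagAndSetEquality using (∼bag⇒↭)
open import Data.List.Relation.Binary.Permutation.Propositional.Properties using () renaming (map⁺ to ↭-map⁺)
open import Data.List.Membership.Propositional using (_∈_; find; lose)
open import Data.List.Membership.Propositional.Properties
open import Data.List.Membership.Propositional.Properties.WithK using (unique∧set⇒bag)
open import Data.Product using (∃; ∃₂; _×_; _,_; proj₁; proj₂)
open import Data.Empty using (⊥-elim)
open import Function using (_∘_; flip; mk⇔)
open import Relation.Nullary using (Dec; yes; no; ¬_; ¬?; _×-dec_)
open import Relation.Unary using (Decidable)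
open import Relation.Binary.PropositionalEquality
open import Algebra.Properties.CommutativeSemigroup +-commutativeSemigroup
  using () renaming (interchange to +-interchange)
open import Algebra.Properties.CommutativeSemigroup *-commutativeSemigroup
  using () renaming (x∙yz≈y∙xz to *-leftComm; xy∙z≈xz∙y to *-rightComm)

𝟙 : ∀ {p} {P : Set p} → Dec P → ℕ
𝟙 (yes _) = 1
𝟙 (no _) = 0

𝟙-yes : ∀ {p} {P : Set p} (d : Dec P) → P → 𝟙 d ≡ 1
𝟙-yes (yes _) _ = refl
𝟙-yes (no ¬p) p = ⊥-elim (¬p p)

𝟙-no : ∀ {p} {P : Set p} (d : Dec P) → ¬ P → 𝟙 d ≡ 0
𝟙-no (yes p) ¬p = ⊥-elim (¬p p)
𝟙-no (no _) _ = refl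

𝟙-⇔ : ∀ {p q} {P : Set p} {Q : Set q} (d : Dec P) (e : Dec Q) → (P → Q) → (Q → P) → 𝟙 d ≡ 𝟙 e
𝟙-⇔ (yes p) (yes q) f g = refl
𝟙-⇔ (yes p) (no ¬q) f g = ⊥-elim (¬q (f p))
𝟙-⇔ (no ¬p) (yes q) f g = ⊥-elim (¬p (g q))
𝟙-⇔ (no _) (no _) f g = refl

𝟙-× : ∀ {p q} {P : Set p} {Q : Set q} (a : Dec P) (b : Dec Q) → 𝟙 (a ×-dec b) ≡ 𝟙 a * 𝟙 b
𝟙-× (yes _) (yes _) = refl
𝟙-× (yes _) (no _) = refl
𝟙-× (no _) (yes _) = refl
𝟙-× (no _) (no _) = refl

*-vanishʳ : ∀ a {b} → b ≡ 0 → a * b ≡ 0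
*-vanishʳ a refl = *-zeroʳ a

sumTo : ℕ → (ℕ → ℕ) → ℕ
sumTo zero f = f zero
sumTo (suc n) f = sumTo n f + f (suc n)

sumTo-cong : ∀ n {f g : ℕ → ℕ} → (∀ i → i ≤ n → f i ≡ g i) → sumTo n f ≡ sumTo n g
sumTo-cong zero h = h 0 z≤n
sumTo-cong (suc n) h = cong₂ _+_ (sumTo-cong n (λ i i≤n → h i (m≤n⇒m≤1+n i≤n))) (h (suc n) ≤-refl)

sumTo-ext : ∀ n {f g : ℕ → ℕ} → (∀ i → f i ≡ g i) → sumTo n f ≡ sumTo n g
sumTo-ext n h = sumTo-cong n (λ i _ → h i)

sumTo-zero : ∀ n {f : ℕ → ℕ} → (∀ i → i ≤ n → f i ≡ 0) → sumTo n f ≡ 0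
sumTo-zero zero h = h 0 z≤n
sumTo-zero (suc n) h
  rewrite sumTo-zero n (λ i i≤n → h i (m≤n⇒m≤1+n i≤n)) = h (suc n) ≤-refl

sumTo-+ : ∀ n (f g : ℕ → ℕ) → sumTo n (λ i → f i + g i) ≡ sumTo n f + sumTo n g
sumTo-+ zero f g = refl
sumTo-+ (suc n) f g rewrite sumTo-+ n f g = +-interchange (sumTo n f) (sumTo n g) (f (suc n)) (g (suc n))

sumTo-*ˡ : ∀ n c (f : ℕ → ℕ) → sumTo n (λ i → c * f i) ≡ c * sumTo n f
sumTo-*ˡ zero c f = refl
sumTo-*ˡ (suc n) c f rewrite sumTo-*ˡ n c f = sym (*-distribˡ-+ c (sumTo n f) (f (suc n)))

sumTo-*ʳ : ∀ n c (f : ℕ → ℕ) → sumTo n (λ i → f i * c) ≡ sumTo n f * c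
sumTo-*ʳ n c f = trans (sumTo-ext n (λ i → *-comm (f i) c)) (trans (sumTo-*ˡ n c f) (*-comm c (sumTo n f)))

sumTo-swap : ∀ n m (f : ℕ → ℕ → ℕ) →
  sumTo n (λ i → sumTo m (λ j → f i j)) ≡ sumTo m (λ j → sumTo n (λ i → f i j))
sumTo-swap zero m f = refl
sumTo-swap (suc n) m f rewrite sumTo-swap n m f = sym (sumTo-+ m (λ j → sumTo n (λ i → f i j)) (f (suc n)))

sumTo-sucˡ : ∀ n (f : ℕ → ℕ) → sumTo (suc n) f ≡ f 0 + sumTo n (f ∘ suc)
sumTo-sucˡ zero f = refl
sumTo-sucˡ (suc n) f rewrite sumTo-sucˡ n f = +-assoc (f 0) (sumTo n (f ∘ suc)) (f (suc (suc n)))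

sumTo-reverse : ∀ n (f : ℕ → ℕ) → sumTo n f ≡ sumTo n (λ i → f (n ∸ i))
sumTo-reverse zero f = refl
sumTo-reverse (suc n) f = begin
  sumTo n f + f (suc n)                     ≡⟨ +-comm (sumTo n f) (f (suc n)) ⟩
  f (suc n) + sumTo n f                     ≡⟨ cong (f (suc n) +_) (sumTo-reverse n f) ⟩
  f (suc n) + sumTo n (λ i → f (n ∸ i))     ≡⟨ sumTo-sucˡ n (λ i → f (suc n ∸ i)) ⟨
  sumTo (suc n) (λ i → f (suc n ∸ i))       ∎
  where open ≡-Reasoning

sumTo-single : ∀ n x {f : ℕ → ℕ} → x ≤ n → (∀ i → i ≤ n → i ≢ x → f i ≡ 0) →
               sumTo n f ≡ f x
sumTo-single zero zero z≤n h = refl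
sumTo-single (suc n) x {f} x≤1+n h with x ≟ suc n
... | yes refl =
  cong (_+ f (suc n)) (sumTo-zero n (λ i i≤n → h i (m≤n⇒m≤1+n i≤n) (λ { refl → 1+n≰n i≤n })))
... | no x≢1+n = trans (cong₂ _+_ (sumTo-single n x x≤n (λ i i≤n → h i (m≤n⇒m≤1+n i≤n)))
                                  (h (suc n) ≤-refl (x≢1+n ∘ sym)))
                       (+-identityʳ (f x))
  where x≤n = ≤-pred (≤∧≢⇒< x≤1+n x≢1+n)

sumTo-pad : ∀ n m {f : ℕ → ℕ} → n ≤ m → (∀ i → n < i → f i ≡ 0) → sumTo m f ≡ sumTo n f
sumTo-pad n zero {f} z≤n h = refl
sumTo-pad n (suc m) {f} n≤1+m h with n ≟ suc m
... | yes refl = refl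
... | no n≢1+m = begin
  sumTo m f + f (suc m)   ≡⟨ cong₂ _+_ (sumTo-pad n m n≤m h) (h (suc m) (s≤s n≤m)) ⟩
  sumTo n f + 0           ≡⟨ +-identityʳ _ ⟩
  sumTo n f               ∎
  where open ≡-Reasoning
        n≤m = ≤-pred (≤∧≢⇒< n≤1+m n≢1+m)

sumTo-𝟙≡ : ∀ n x (g : ℕ → ℕ) → sumTo n (λ b → 𝟙 (x ≟ b) * g b) ≡ 𝟙 (x ≤? n) * g x
sumTo-𝟙≡ n x g with x ≤? n
... | yes x≤n = trans (sumTo-single n x x≤n (λ i _ i≢x → cong (_* g i) (𝟙-no (x ≟ i) (i≢x ∘ sym))))
                      (cong (_* g x) (𝟙-yes (x ≟ x) refl))
... | no x≰n = sumTo-zero n (λ i i≤n → cong (_* g i) (𝟙-no (x ≟ i) (λ { refl → x≰n i≤n })))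

sumTo-triangle : ∀ n (F : ℕ → ℕ → ℕ) →
  sumTo n (λ i → sumTo i (λ a → F a i)) ≡ sumTo n (λ a → sumTo (n ∸ a) (λ b → F a (a + b)))
sumTo-triangle zero F = refl
sumTo-triangle (suc n) F = begin
    sumTo n (λ i → sumTo i (λ a → F a i)) + sumTo (suc n) (λ a → F a (suc n))
  ≡⟨ cong (_+ sumTo (suc n) (λ a → F a (suc n))) (sumTo-triangle n F) ⟩
    rows n + (sumTo n (λ a → F a (suc n)) + F (suc n) (suc n))
  ≡⟨ +-assoc (rows n) _ _ ⟨
    rows n + sumTo n (λ a → F a (suc n)) + F (suc n) (suc n)
  ≡⟨ cong₂ _+_ (sumTo-+ n _ _) (cong (F (suc n)) (+-identityʳ (suc n))) ⟨
    sumTo n (λ a → row n a + F a (suc n)) + F (suc n) (suc n + 0)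
  ≡⟨ cong₂ _+_ (sumTo-cong n extendRow) (cong (λ k → sumTo k (λ b → F (suc n) (suc n + b))) (n∸n≡0 n))
   ⟨
    rows (suc n)
  ∎
  where
  open ≡-Reasoning
  row : ℕ → ℕ → ℕ
  row n a = sumTo (n ∸ a) (λ b → F a (a + b))
  rows : ℕ → ℕ
  rows n = sumTo n (row n)
  extendRow : ∀ a → a ≤ n → row (suc n) a ≡ row n a + F a (suc n)
  extendRow a a≤n rewrite +-∸-assoc 1 a≤n =
    cong (row n a +_) (cong (F a) (trans (+-suc a (n ∸ a)) (cong suc (m+[n∸m]≡n a≤n))))

sum-applyUpTo : ∀ n (f : ℕ → ℕ) → sum (applyUpTo f (suc n)) ≡ sumTo n f
sum-applyUpTo zero f = +-identityʳ (f 0)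
sum-applyUpTo (suc n) f =
  trans (cong (f 0 +_) (sum-applyUpTo n (f ∘ suc))) (sym (sumTo-sucˡ n f))

sum-map-upTo : ∀ n (f : ℕ → ℕ) → sum (map f (upTo (suc n))) ≡ sumTo n f
sum-map-upTo n f = trans (cong sum (map-upTo f (suc n))) (sum-applyUpTo n f)

data EvenOrOdd : ℕ → Set where
  even : ∀ t → EvenOrOdd (t * 2)
  odd : ∀ t → EvenOrOdd (suc (t * 2))

evenOrOdd : ∀ n → EvenOrOdd n
evenOrOdd zero = even 0
evenOrOdd (suc n) with evenOrOdd n
... | even t = odd t
... | odd t = even (suc t)

m*2≢1+n*2 : ∀ m n → m * 2 ≢ suc (n * 2)
m*2≢1+n*2 m n e = even≢odd m n (trans (*-comm 2 m) (trans e (cong suc (*-comm n 2))))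

2∤1+n*2 : ∀ n → ¬ (2 ∣ suc (n * 2))
2∤1+n*2 n (divides q e) = m*2≢1+n*2 q n (sym e)

-- Formal power series

Series : Set
Series = ℕ → ℕ

infixl 7 _⋆_
_⋆_ : Series → Series → Series
(f ⋆ g) n = sumTo n (λ i → f i * g (n ∸ i))

infixl 6 _⊕_
_⊕_ : Series → Series → Series
(f ⊕ g) n = f n + g n

0ₛ : Series
0ₛ _ = 0

δ : Series
δ zero = 1
δ (suc _) = 0

ones : Series
ones _ = 1

⋆-comm : ∀ f g → f ⋆ g ≗ g ⋆ f
⋆-comm f g n = trans (sumTo-reverse n _) (sumTo-cong n (λ i i≤n →
  trans (cong (λ k → f (n ∸ i) * g k) (m∸[m∸n]≡n i≤n)) (*-comm (f (n ∸ i)) (g i))))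

⋆-congˡ : ∀ {f f′} g → f ≗ f′ → f ⋆ g ≗ f′ ⋆ g
⋆-congˡ g e n = sumTo-ext n (λ i → cong (_* g (n ∸ i)) (e i))

⋆-congʳ : ∀ f {g g′} → g ≗ g′ → f ⋆ g ≗ f ⋆ g′
⋆-congʳ f e n = sumTo-ext n (λ i → cong (f i *_) (e (n ∸ i)))

⋆-cong : ∀ {f f′ g g′} → f ≗ f′ → g ≗ g′ → f ⋆ g ≗ f′ ⋆ g′
⋆-cong {f′ = f′} {g = g} e₁ e₂ n = trans (⋆-congˡ g e₁ n) (⋆-congʳ f′ e₂ n)

⋆-distribˡ-⊕ : ∀ f g h → f ⋆ (g ⊕ h) ≗ f ⋆ g ⊕ f ⋆ h
⋆-distribˡ-⊕ f g h n =
  trans (sumTo-ext n (λ i → *-distribˡ-+ (f i) (g (n ∸ i)) (h (n ∸ i)))) (sumTo-+ n _ _)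

⋆-distribʳ-⊕ : ∀ f g h → (g ⊕ h) ⋆ f ≗ g ⋆ f ⊕ h ⋆ f
⋆-distribʳ-⊕ f g h n =
  trans (sumTo-ext n (λ i → *-distribʳ-+ (f (n ∸ i)) (g i) (h i))) (sumTo-+ n _ _)

⋆-zeroʳ : ∀ f → f ⋆ 0ₛ ≗ 0ₛ
⋆-zeroʳ f n = sumTo-zero n (λ i _ → *-zeroʳ (f i))

⋆-zeroˡ : ∀ f → 0ₛ ⋆ f ≗ 0ₛ
⋆-zeroˡ f n = sumTo-zero n (λ _ _ → refl)

⋆-identityˡ : ∀ f → δ ⋆ f ≗ f
⋆-identityˡ f zero = +-identityʳ (f 0)
⋆-identityˡ f (suc n) = begin
  sumTo (suc n) (λ i → δ i * f (suc n ∸ i))       ≡⟨ sumTo-sucˡ n _ ⟩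
  f (suc n) + 0 + sumTo n (λ i → 0 * f (n ∸ i))   ≡⟨ cong (f (suc n) + 0 +_) (sumTo-zero n λ _ _ → refl) ⟩
  f (suc n) + 0 + 0                               ≡⟨ cong (_+ 0) (+-identityʳ (f (suc n))) ⟩
  f (suc n) + 0                                   ≡⟨ +-identityʳ (f (suc n)) ⟩
  f (suc n)                                       ∎
  where open ≡-Reasoning

⋆-identityʳ : ∀ f → f ⋆ δ ≗ f
⋆-identityʳ f n = trans (⋆-comm f δ n) (⋆-identityˡ f n)

⋆-assoc : ∀ f g h → (f ⋆ g) ⋆ h ≗ f ⋆ (g ⋆ h)
⋆-assoc f g h n = begin
    sumTo n (λ i → sumTo i (λ a → f a * g (i ∸ a)) * h (n ∸ i))
  ≡⟨ sumTo-ext n (λ i → sumTo-*ʳ i (h (n ∸ i)) _) ⟨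
    sumTo n (λ i → sumTo i (λ a → f a * g (i ∸ a) * h (n ∸ i)))
  ≡⟨ sumTo-triangle n (λ a i → f a * g (i ∸ a) * h (n ∸ i)) ⟩
    sumTo n (λ a → sumTo (n ∸ a) (λ b → f a * g (a + b ∸ a) * h (n ∸ (a + b))))
  ≡⟨ sumTo-ext n (λ a → trans (sumTo-ext (n ∸ a) (reindex a)) (sumTo-*ˡ (n ∸ a) (f a) _)) ⟩
    sumTo n (λ a → f a * sumTo (n ∸ a) (λ b → g b * h (n ∸ a ∸ b)))
  ∎
  where
  open ≡-Reasoning
  reindex : ∀ a b → f a * g (a + b ∸ a) * h (n ∸ (a + b)) ≡ f a * (g b * h (n ∸ a ∸ b))
  reindex a b = trans (cong₂ (λ u v → f a * g u * h v) (m+n∸m≡n a b) (sym (∸-+-assoc n a b)))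
                      (*-assoc (f a) (g b) (h (n ∸ a ∸ b)))

⋆-comm-right : ∀ a b c → (a ⋆ b) ⋆ c ≗ (a ⋆ c) ⋆ b
⋆-comm-right a b c n = begin
  ((a ⋆ b) ⋆ c) n   ≡⟨ ⋆-assoc a b c n ⟩
  (a ⋆ (b ⋆ c)) n   ≡⟨ ⋆-congʳ a (⋆-comm b c) n ⟩
  (a ⋆ (c ⋆ b)) n   ≡⟨ ⋆-assoc a c b n ⟨
  ((a ⋆ c) ⋆ b) n   ∎
  where open ≡-Reasoning

⋆-interchange : ∀ a b c d → (a ⋆ b) ⋆ (c ⋆ d) ≗ (a ⋆ c) ⋆ (b ⋆ d)
⋆-interchange a b c d n = begin
  ((a ⋆ b) ⋆ (c ⋆ d)) n   ≡⟨ ⋆-assoc a b (c ⋆ d) n ⟩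
  (a ⋆ (b ⋆ (c ⋆ d))) n   ≡⟨ ⋆-congʳ a (λ m → sym (⋆-assoc b c d m)) n ⟩
  (a ⋆ ((b ⋆ c) ⋆ d)) n   ≡⟨ ⋆-congʳ a (⋆-congˡ d (⋆-comm b c)) n ⟩
  (a ⋆ ((c ⋆ b) ⋆ d)) n   ≡⟨ ⋆-congʳ a (⋆-assoc c b d) n ⟩
  (a ⋆ (c ⋆ (b ⋆ d))) n   ≡⟨ ⋆-assoc a c (b ⋆ d) n ⟨
  ((a ⋆ c) ⋆ (b ⋆ d)) n   ∎
  where open ≡-Reasoning

infix 4 _≈[_]_
_≈[_]_ : Series → ℕ → Series → Set
f ≈[ T ] g = ∀ n → n ≤ T → f n ≡ g n

≈-trans : ∀ {f g h} T → f ≈[ T ] g → g ≈[ T ] h → f ≈[ T ] h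
≈-trans T f≈g g≈h n n≤T = trans (f≈g n n≤T) (g≈h n n≤T)

⋆-cong-≈ : ∀ {f f′ g g′} T → f ≈[ T ] f′ → g ≈[ T ] g′ → f ⋆ g ≈[ T ] f′ ⋆ g′
⋆-cong-≈ T e₁ e₂ n n≤T = sumTo-cong n (λ i i≤n →
  cong₂ _*_ (e₁ i (≤-trans i≤n n≤T)) (e₂ (n ∸ i) (≤-trans (m∸n≤m n i) n≤T)))

⋆-identityʳ-≈ : ∀ f Z T → Z ≈[ T ] δ → f ⋆ Z ≈[ T ] f
⋆-identityʳ-≈ f Z T Z≈δ n n≤T =
  trans (⋆-cong-≈ {f} {f} T (λ _ _ → refl) Z≈δ n n≤T) (⋆-identityʳ f n)

-- A series with constant term 1 is invertible, so it can be cancelled degree by degree.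
⋆-cancelʳ-≈ : ∀ {f g} Y T → Y 0 ≡ 1 → f ⋆ Y ≈[ T ] g ⋆ Y → f ≈[ T ] g
⋆-cancelʳ-≈ {f} {g} Y T Y₀≡1 fY≈gY n n≤T = agreeTo n n≤T n ≤-refl
  where
  lastTerm : ∀ h n → h n * Y (n ∸ n) ≡ h n
  lastTerm h n = trans (cong (λ k → h n * Y k) (n∸n≡0 n)) (trans (cong (h n *_) Y₀≡1) (*-identityʳ (h n)))
  agreeTo : ∀ n → n ≤ T → ∀ i → i ≤ n → f i ≡ g i
  agreeTo zero _ zero _ = trans (sym (lastTerm f 0)) (trans (fY≈gY 0 z≤n) (lastTerm g 0))
  agreeTo (suc n) 1+n≤T i i≤1+n with i ≟ suc n
  ... | no i≢1+n = agreeTo n (≤-trans (n≤1+n n) 1+n≤T) i (≤-pred (≤∧≢⇒< i≤1+n i≢1+n))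
  ... | yes refl = +-cancelˡ-≡ (lower f) _ _ (begin
      lower f + f (suc n)         ≡⟨ cong (lower f +_) (lastTerm f (suc n)) ⟨
      (f ⋆ Y) (suc n)             ≡⟨ fY≈gY (suc n) 1+n≤T ⟩
      (g ⋆ Y) (suc n)             ≡⟨ cong₂ _+_ (sumTo-cong n lowerAgree) (sym (lastTerm g (suc n))) ⟨
      lower f + g (suc n)         ∎)
    where
    open ≡-Reasoning
    lower : Series → ℕ
    lower h = sumTo n (λ i → h i * Y (suc n ∸ i))
    lowerAgree : ∀ i → i ≤ n → f i * Y (suc n ∸ i) ≡ g i * Y (suc n ∸ i)
    lowerAgree i i≤n = cong (_* Y (suc n ∸ i)) (agreeTo n (≤-trans (n≤1+n n) 1+n≤T) i i≤n)

-- dilate K c is the series c(x^K).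
dilate : ℕ → Series → Series
dilate K c j = sumTo j (λ m → 𝟙 (m * K ≟ j) * c m)

dilate-gap : ∀ K c j → 0 < j → j < K → dilate K c j ≡ 0
dilate-gap K c j 0<j j<K = sumTo-zero j (λ m _ → cong (_* c m) (𝟙-no (m * K ≟ j) (mK≢j m)))
  where
  mK≢j : ∀ m → m * K ≢ j
  mK≢j zero e = <⇒≢ 0<j e
  mK≢j (suc m) e = <⇒≱ j<K (subst (K ≤_) e (m≤m+n K (m * K)))

dilate-⊕ : ∀ K c d → dilate K (c ⊕ d) ≗ dilate K c ⊕ dilate K d
dilate-⊕ K c d j = trans (sumTo-ext j (λ m → *-distribˡ-+ (𝟙 (m * K ≟ j)) (c m) (d m))) (sumTo-+ j _ _)

dilate-δ : ∀ K → dilate K δ ≗ δ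
dilate-δ K zero = refl
dilate-δ K (suc j) =
  trans (sumTo-sucˡ j _) (sumTo-zero j (λ i _ → *-zeroʳ (𝟙 (suc i * K ≟ suc j))))

dilate-0ₛ : ∀ K → dilate K 0ₛ ≗ 0ₛ
dilate-0ₛ K j = sumTo-zero j (λ m _ → *-zeroʳ (𝟙 (m * K ≟ j)))

dilate-cong : ∀ K {c d} → c ≗ d → dilate K c ≗ dilate K d
dilate-cong K c≗d j = sumTo-ext j (λ m → cong (𝟙 (m * K ≟ j) *_) (c≗d m))

dilate-⋆ : ∀ K .{{_ : NonZero K}} c f n →
  (dilate K c ⋆ f) n ≡ sumTo n (λ m → 𝟙 (m * K ≤? n) * (c m * f (n ∸ m * K)))
dilate-⋆ K c f n = begin
    sumTo n (λ i → sumTo i (λ m → 𝟙 (m * K ≟ i) * c m) * f (n ∸ i))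
  ≡⟨ sumTo-ext n (λ i → sumTo-*ʳ i (f (n ∸ i)) _) ⟨
    sumTo n (λ i → sumTo i (λ m → 𝟙 (m * K ≟ i) * c m * f (n ∸ i)))
  ≡⟨ sumTo-triangle n (λ m i → 𝟙 (m * K ≟ i) * c m * f (n ∸ i)) ⟩
    sumTo n (λ m → sumTo (n ∸ m) (λ b → 𝟙 (m * K ≟ m + b) * c m * f (n ∸ (m + b))))
  ≡⟨ sumTo-cong n termOf ⟩
    sumTo n (λ m → 𝟙 (m * K ≤? n) * (c m * f (n ∸ m * K)))
  ∎
  where
  open ≡-Reasoning
  termOf : ∀ m → m ≤ n → sumTo (n ∸ m) (λ b → 𝟙 (m * K ≟ m + b) * c m * f (n ∸ (m + b)))
                            ≡ 𝟙 (m * K ≤? n) * (c m * f (n ∸ m * K))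
  termOf m m≤n = begin
      sumTo (n ∸ m) (λ b → 𝟙 (m * K ≟ m + b) * c m * f (n ∸ (m + b)))
    ≡⟨ sumTo-ext (n ∸ m) (λ b → trans (cong (λ z → z * c m * f (n ∸ (m + b))) (shift b))
                                         (*-assoc (𝟙 (m * K ∸ m ≟ b)) (c m) _)) ⟩
      sumTo (n ∸ m) (λ b → 𝟙 (m * K ∸ m ≟ b) * (c m * f (n ∸ (m + b))))
    ≡⟨ sumTo-𝟙≡ (n ∸ m) (m * K ∸ m) (λ b → c m * f (n ∸ (m + b))) ⟩
      𝟙 (m * K ∸ m ≤? n ∸ m) * (c m * f (n ∸ (m + (m * K ∸ m))))
    ≡⟨ cong₂ _*_ inRange (cong (λ z → c m * f (n ∸ z)) (m+[n∸m]≡n m≤mK)) ⟩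
      𝟙 (m * K ≤? n) * (c m * f (n ∸ m * K))
    ∎
    where
    m≤mK : m ≤ m * K
    m≤mK = m≤m*n m K
    shift : ∀ b → 𝟙 (m * K ≟ m + b) ≡ 𝟙 (m * K ∸ m ≟ b)
    shift b = 𝟙-⇔ (m * K ≟ m + b) (m * K ∸ m ≟ b)
      (λ e → trans (cong (_∸ m) e) (m+n∸m≡n m b))
      (λ e → trans (sym (m+[n∸m]≡n m≤mK)) (cong (m +_) e))
    inRange : 𝟙 (m * K ∸ m ≤? n ∸ m) ≡ 𝟙 (m * K ≤? n)
    inRange = 𝟙-⇔ (m * K ∸ m ≤? n ∸ m) (m * K ≤? n)
      (λ le → subst₂ _≤_ (m∸n+n≡m m≤mK) (m∸n+n≡m m≤n) (+-monoˡ-≤ m le))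
      (∸-monoˡ-≤ m)

dilate-∸ : ∀ K .{{_ : NonZero K}} d n a → a * K ≤ n →
  dilate K d (n ∸ a * K) ≡ sumTo n (λ p → 𝟙 ((a + p) * K ≟ n) * d p)
dilate-∸ K d n a aK≤n = begin
    sumTo (n ∸ a * K) (λ p → 𝟙 (p * K ≟ n ∸ a * K) * d p)
  ≡⟨ sumTo-ext (n ∸ a * K) (λ p → cong (_* d p) (shift p)) ⟩
    sumTo (n ∸ a * K) (λ p → 𝟙 ((a + p) * K ≟ n) * d p)
  ≡⟨ sumTo-pad (n ∸ a * K) n (m∸n≤m n (a * K)) beyond ⟨
    sumTo n (λ p → 𝟙 ((a + p) * K ≟ n) * d p)
  ∎
  where
  open ≡-Reasoning
  pK≡n∸aK : ∀ {p} → (a + p) * K ≡ n → p * K ≡ n ∸ a * K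
  pK≡n∸aK {p} e =
    trans (sym (m+n∸m≡n (a * K) (p * K))) (cong (_∸ a * K) (trans (sym (*-distribʳ-+ K a p)) e))
  shift : ∀ p → 𝟙 (p * K ≟ n ∸ a * K) ≡ 𝟙 ((a + p) * K ≟ n)
  shift p = 𝟙-⇔ (p * K ≟ n ∸ a * K) ((a + p) * K ≟ n)
    (λ e → trans (*-distribʳ-+ K a p) (trans (cong (a * K +_) e) (m+[n∸m]≡n aK≤n)))
    pK≡n∸aK
  beyond : ∀ p → n ∸ a * K < p → 𝟙 ((a + p) * K ≟ n) * d p ≡ 0
  beyond p n∸aK<p = cong (_* d p) (𝟙-no ((a + p) * K ≟ n) λ e →
    <⇒≱ n∸aK<p (subst (p ≤_) (pK≡n∸aK e) (m≤m*n p K)))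

dilate-⋆-dilate : ∀ K .{{_ : NonZero K}} c d → dilate K c ⋆ dilate K d ≗ dilate K (c ⋆ d)
dilate-⋆-dilate K c d n = begin
    (dilate K c ⋆ dilate K d) n
  ≡⟨ dilate-⋆ K c (dilate K d) n ⟩
    sumTo n (λ m → 𝟙 (m * K ≤? n) * (c m * dilate K d (n ∸ m * K)))
  ≡⟨ sumTo-ext n pairs ⟩
    sumTo n (λ m → sumTo n (λ p → 𝟙 ((m + p) * K ≟ n) * (c m * d p)))
  ≡⟨ sumTo-cong n (λ m m≤n → sumTo-pad (n ∸ m) n (m∸n≤m n m) (beyond m)) ⟩
    sumTo n (λ m → sumTo (n ∸ m) (λ b → 𝟙 ((m + b) * K ≟ n) * (c m * d b)))
  ≡⟨ sumTo-ext n (λ m → sumTo-ext (n ∸ m) (λ b →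
       cong (λ z → 𝟙 ((m + b) * K ≟ n) * (c m * d z)) (m+n∸m≡n m b))) ⟨
    sumTo n (λ m → sumTo (n ∸ m) (λ b → 𝟙 ((m + b) * K ≟ n) * (c m * d (m + b ∸ m))))
  ≡⟨ sumTo-triangle n (λ m M → 𝟙 (M * K ≟ n) * (c m * d (M ∸ m))) ⟨
    sumTo n (λ M → sumTo M (λ m → 𝟙 (M * K ≟ n) * (c m * d (M ∸ m))))
  ≡⟨ sumTo-ext n (λ M → sumTo-*ˡ M (𝟙 (M * K ≟ n)) (λ m → c m * d (M ∸ m))) ⟩
    dilate K (c ⋆ d) n
  ∎
  where
  open ≡-Reasoning
  beyond : ∀ m p → n ∸ m < p → 𝟙 ((m + p) * K ≟ n) * (c m * d p) ≡ 0
  beyond m p n∸m<p = cong (_* (c m * d p)) (𝟙-no ((m + p) * K ≟ n) λ e →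
    <⇒≱ n∸m<p (m+n≤o⇒m≤o∸n p (subst (_≤ n) (+-comm m p) (subst (m + p ≤_) e (m≤m*n (m + p) K)))))
  pairs : ∀ m → 𝟙 (m * K ≤? n) * (c m * dilate K d (n ∸ m * K))
                ≡ sumTo n (λ p → 𝟙 ((m + p) * K ≟ n) * (c m * d p))
  pairs m with m * K ≤? n
  ... | no mK≰n = sym (sumTo-zero n (λ p _ → cong (_* (c m * d p)) (𝟙-no ((m + p) * K ≟ n)
          (λ e → mK≰n (subst (m * K ≤_) e (*-monoˡ-≤ K (m≤m+n m p)))))))
  ... | yes mK≤n = trans (+-identityʳ _) (trans (cong (c m *_) (dilate-∸ K d n m mK≤n)) (trans
          (sym (sumTo-*ˡ n (c m) _)) (sumTo-ext n (λ p → *-leftComm (c m) (𝟙 ((m + p) * K ≟ n)) (d p)))))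

dilate-* : ∀ K L .{{_ : NonZero K}} .{{_ : NonZero L}} c → dilate (K * L) c ≗ dilate K (dilate L c)
dilate-* K L c j = sym (begin
    sumTo j (λ a → 𝟙 (a * K ≟ j) * sumTo a (λ m → 𝟙 (m * L ≟ a) * c m))
  ≡⟨ sumTo-cong j (λ a a≤j → sym (trans (sumTo-pad a j a≤j (beyond a)) (sumTo-*ˡ a (𝟙 (a * K ≟ j)) _))) ⟩
    sumTo j (λ a → sumTo j (λ m → 𝟙 (a * K ≟ j) * (𝟙 (m * L ≟ a) * c m)))
  ≡⟨ sumTo-swap j j _ ⟩
    sumTo j (λ m → sumTo j (λ a → 𝟙 (a * K ≟ j) * (𝟙 (m * L ≟ a) * c m)))
  ≡⟨ sumTo-ext j (λ m → trans (sumTo-ext j (λ a → *-leftComm (𝟙 (a * K ≟ j)) (𝟙 (m * L ≟ a)) (c m)))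
                             (sumTo-𝟙≡ j (m * L) (λ a → 𝟙 (a * K ≟ j) * c m))) ⟩
    sumTo j (λ m → 𝟙 (m * L ≤? j) * (𝟙 (m * L * K ≟ j) * c m))
  ≡⟨ sumTo-ext j (λ m → trans (sym (*-assoc (𝟙 (m * L ≤? j)) _ _)) (cong (_* c m) (combine m))) ⟩
    sumTo j (λ m → 𝟙 (m * (K * L) ≟ j) * c m)
  ∎)
  where
  open ≡-Reasoning
  beyond : ∀ a m → a < m → 𝟙 (a * K ≟ j) * (𝟙 (m * L ≟ a) * c m) ≡ 0
  beyond a m a<m = *-vanishʳ (𝟙 (a * K ≟ j))
    (cong (_* c m) (𝟙-no (m * L ≟ a) (λ e → <⇒≱ a<m (subst (m ≤_) e (m≤m*n m L)))))
  reassoc : ∀ m → m * L * K ≡ m * (K * L)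
  reassoc m = trans (*-assoc m L K) (cong (m *_) (*-comm L K))
  combine : ∀ m → 𝟙 (m * L ≤? j) * 𝟙 (m * L * K ≟ j) ≡ 𝟙 (m * (K * L) ≟ j)
  combine m with m * L * K ≟ j | m * (K * L) ≟ j
  ... | yes e | yes _ = trans (*-identityʳ _) (𝟙-yes (m * L ≤? j) (subst (m * L ≤_) e (m≤m*n (m * L) K)))
  ... | no _  | no _  = *-zeroʳ (𝟙 (m * L ≤? j))
  ... | yes e | no ne = ⊥-elim (ne (trans (sym (reassoc m)) e))
  ... | no ne | yes e = ⊥-elim (ne (trans (reassoc m) e))

module _ {A B : Set} where

  concatMap-∈⁻ : ∀ {f : A → List B} {xs y} → y ∈ concatMap f xs → ∃ λ x → x ∈ xs × y ∈ f x
  concatMap-∈⁻ {f = f} y∈ = find (∈-concatMap⁻ f y∈)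

  concatMap-∈⁺ : ∀ {f : A → List B} {xs x y} → x ∈ xs → y ∈ f x → y ∈ concatMap f xs
  concatMap-∈⁺ {f = f} x∈ y∈ = ∈-concatMap⁺ f (lose x∈ y∈)

  -- key recovers the block a member comes from, so distinct blocks are disjoint.
  concatMap-unique : (key : B → A) (f : A → List B) (xs : List A) → Unique xs → (∀ x → Unique (f x)) →
                     (∀ x y → y ∈ f x → key y ≡ x) → Unique (concatMap f xs)
  concatMap-unique key f [] _ _ _ = []
  concatMap-unique key f (x ∷ xs) (x∉xs ∷ uxs) uf keyOf =
    UniqueP.++⁺ (uf x) (concatMap-unique key f xs uxs uf keyOf) disjoint
    where
    disjoint : ∀ {y} → ¬ (y ∈ f x × y ∈ concatMap f xs)
    disjoint {y} (y∈fx , y∈rest) with concatMap-∈⁻ {xs = xs} y∈rest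
    ... | x′ , x′∈xs , y∈fx′ =
      All.lookup x∉xs x′∈xs (trans (sym (keyOf x y y∈fx)) (keyOf x′ y y∈fx′))

module _ {A : Set} where

  guard : ∀ {p} {P : Set p} → Dec P → List A → List A
  guard (yes _) xs = xs
  guard (no _) _ = []

  ∈-guard⁺ : ∀ {p} {P : Set p} (d : Dec P) {xs : List A} {y} → P → y ∈ xs → y ∈ guard d xs
  ∈-guard⁺ (yes _) _ y∈ = y∈
  ∈-guard⁺ (no ¬p) p _ = ⊥-elim (¬p p)

  ∈-guard⁻ : ∀ {p} {P : Set p} (d : Dec P) {xs : List A} {y} → y ∈ guard d xs → P × y ∈ xs
  ∈-guard⁻ (yes p) y∈ = p , y∈
  ∈-guard⁻ (no _) ()

  guard-unique : ∀ {p} {P : Set p} (d : Dec P) {xs : List A} → Unique xs → Unique (guard d xs)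
  guard-unique (yes _) u = u
  guard-unique (no _) _ = []

  sum-map-cong : ∀ (xs : List A) {f g : A → ℕ} → (∀ {x} → x ∈ xs → f x ≡ g x) →
                 sum (map f xs) ≡ sum (map g xs)
  sum-map-cong [] _ = refl
  sum-map-cong (x ∷ xs) f≡g = cong₂ _+_ (f≡g (here refl)) (sum-map-cong xs (f≡g ∘ there))

  sum-map-+ : ∀ (xs : List A) (f g : A → ℕ) →
              sum (map (λ x → f x + g x) xs) ≡ sum (map f xs) + sum (map g xs)
  sum-map-+ [] f g = refl
  sum-map-+ (x ∷ xs) f g rewrite sum-map-+ xs f g = +-interchange (f x) (g x) _ _

  sum-map-*ˡ : ∀ (xs : List A) c (f : A → ℕ) → sum (map (λ x → c * f x) xs) ≡ c * sum (map f xs)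
  sum-map-*ˡ [] c f = sym (*-zeroʳ c)
  sum-map-*ˡ (x ∷ xs) c f = trans (cong (c * f x +_) (sum-map-*ˡ xs c f)) (sym (*-distribˡ-+ c (f x) _))

  sum-map-≤ : ∀ (xs : List A) (f g : A → ℕ) → (∀ x → f x ≤ g x) → sum (map f xs) ≤ sum (map g xs)
  sum-map-≤ [] f g _ = z≤n
  sum-map-≤ (x ∷ xs) f g f≤g = +-mono-≤ (f≤g x) (sum-map-≤ xs f g f≤g)

  sum-map-filter : ∀ {P : A → Set} (P? : Decidable P) (f : A → ℕ) xs →
                   sum (map f (filter P? xs)) ≡ sum (map (λ x → 𝟙 (P? x) * f x) xs)
  sum-map-filter P? f [] = refl
  sum-map-filter P? f (x ∷ xs) with P? x
  ... | yes _ = cong₂ _+_ (sym (+-identityʳ (f x))) (sum-map-filter P? f xs)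
  ... | no _ = sum-map-filter P? f xs

  length-filter : ∀ {P : A → Set} (P? : Decidable P) xs →
                  length (filter P? xs) ≡ sum (map (λ x → 𝟙 (P? x)) xs)
  length-filter P? [] = refl
  length-filter P? (x ∷ xs) with P? x
  ... | yes _ = cong suc (length-filter P? xs)
  ... | no _ = length-filter P? xs

  length≡sum-map-1 : ∀ (xs : List A) → length xs ≡ sum (map (λ _ → 1) xs)
  length≡sum-map-1 [] = refl
  length≡sum-map-1 (x ∷ xs) = cong suc (length≡sum-map-1 xs)

  sum-map-guard : ∀ {p} {P : Set p} (d : Dec P) (F : A → ℕ) xs →
                  sum (map F (guard d xs)) ≡ 𝟙 d * sum (map F xs)
  sum-map-guard (yes _) F xs = sym (*-identityˡ _)
  sum-map-guard (no _) F xs = refl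

  sum-map-concatMap : ∀ {B : Set} (F : B → ℕ) (f : A → List B) xs →
                      sum (map F (concatMap f xs)) ≡ sum (map (λ x → sum (map F (f x))) xs)
  sum-map-concatMap F f [] = refl
  sum-map-concatMap F f (x ∷ xs) = begin
    sum (map F (f x ++ concatMap f xs))                ≡⟨ cong sum (map-++ F (f x) (concatMap f xs)) ⟩
    sum (map F (f x) ++ map F (concatMap f xs))        ≡⟨ sum-++ (map F (f x)) _ ⟩
    sum (map F (f x)) + sum (map F (concatMap f xs))   ≡⟨ cong (sum (map F (f x)) +_) (sum-map-concatMap F f xs) ⟩
    sum (map F (f x)) + sum (map (λ x → sum (map F (f x))) xs) ∎
    where open ≡-Reasoning


-- Lists without repetitions and with the same members are permutations of each other.
sum-map-unique-≡ : ∀ {A : Set} (F : A → ℕ) {xs ys : List A} → Unique xs → Unique ys →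
                   (∀ {z} → z ∈ xs → z ∈ ys) → (∀ {z} → z ∈ ys → z ∈ xs) →
                   sum (map F xs) ≡ sum (map F ys)
sum-map-unique-≡ F uxs uys to from =
  sum-↭ (↭-map⁺ F (∼bag⇒↭ (unique∧set⇒bag uxs uys (mk⇔ to from))))

-- Partitions with bounded parts

sum-replicate : ∀ m K → sum (replicate m K) ≡ m * K
sum-replicate zero K = refl
sum-replicate (suc m) K = cong (K +_) (sum-replicate m K)

length≤sum : ∀ xs → All (1 ≤_) xs → length xs ≤ sum xs
length≤sum [] _ = z≤n
length≤sum (x ∷ xs) (1≤x ∷ ps) = +-mono-≤ 1≤x (length≤sum xs ps)

All≤sum : ∀ xs → All (_≤ sum xs) xs
All≤sum [] = []
All≤sum (x ∷ xs) = m≤m+n x (sum xs) ∷ All.map (λ y≤ → ≤-trans y≤ (m≤n+m (sum xs) x)) (All≤sum xs)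

Linked⇒All≤head : ∀ {x xs} → Linked _≥_ (x ∷ xs) → All (_≤ x) xs
Linked⇒All≤head [-] = []
Linked⇒All≤head (y≤x ∷ l) = Linked⇒All (flip ≤-trans) y≤x l

Linked-∷ : ∀ {x ys} → All (_≤ x) ys → Linked _≥_ ys → Linked _≥_ (x ∷ ys)
Linked-∷ {ys = []} _ _ = [-]
Linked-∷ {ys = y ∷ ys} (y≤x ∷ _) l = y≤x ∷ l

Linked-replicate-++ : ∀ m K {r} → All (_≤ K) r → Linked _≥_ r → Linked _≥_ (replicate m K ++ r)
Linked-replicate-++ zero K _ l = l
Linked-replicate-++ (suc m) K r≤K l =
  Linked-∷ (AllP.++⁺ (AllP.replicate⁺ m ≤-refl) r≤K) (Linked-replicate-++ m K r≤K l)

Linked-++⁻ʳ : ∀ xs {ys : List ℕ} → Linked _≥_ (xs ++ ys) → Linked _≥_ ys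
Linked-++⁻ʳ [] l = l
Linked-++⁻ʳ (x ∷ xs) l = Linked-++⁻ʳ xs (Linked.tail l)

mult-++ : ∀ xs ys i → mult (xs ++ ys) i ≡ mult xs i + mult ys i
mult-++ xs ys i = trans (cong length (filter-++ (_≟ i) xs ys)) (length-++ (filter (_≟ i) xs))

mult-replicate : ∀ m i → mult (replicate m i) i ≡ m
mult-replicate zero i = refl
mult-replicate (suc m) i =
  trans (cong length (filter-accept (_≟ i) {x = i} {xs = replicate m i} refl)) (cong suc (mult-replicate m i))

mult-absent : ∀ xs i → All (_≢ i) xs → mult xs i ≡ 0
mult-absent [] i _ = refl
mult-absent (x ∷ xs) i (x≢i ∷ ps) =
  trans (cong length (filter-reject (_≟ i) {x = x} {xs = xs} x≢i)) (mult-absent xs i ps)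

All≤⇒All≢suc : ∀ {k} xs → All (_≤ k) xs → All (_≢ suc k) xs
All≤⇒All≢suc xs = All.map (λ x≤k x≡1+k → 1+n≰n (subst (_≤ _) x≡1+k x≤k))

mult-replicate-++ : ∀ m k r → All (_≤ k) r → mult (replicate m (suc k) ++ r) (suc k) ≡ m
mult-replicate-++ m k r r≤k = begin
    mult (replicate m (suc k) ++ r) (suc k)
  ≡⟨ mult-++ (replicate m (suc k)) r (suc k) ⟩
    mult (replicate m (suc k)) (suc k) + mult r (suc k)
  ≡⟨ cong₂ _+_ (mult-replicate m (suc k)) (mult-absent r (suc k) (All≤⇒All≢suc r r≤k)) ⟩
    m + 0
  ≡⟨ +-identityʳ m ⟩
    m
  ∎
  where open ≡-Reasoning

-- The partitions of n with parts ≤ k, grouped by the multiplicity m of the part k.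
boundedPartitions : ℕ → ℕ → List (List ℕ)
withTopMultiplicity : ℕ → ℕ → ℕ → List (List ℕ)
boundedPartitions zero zero = [] ∷ []
boundedPartitions zero (suc n) = []
boundedPartitions (suc k) n = concatMap (withTopMultiplicity k n) (upTo (suc n))
withTopMultiplicity k n m =
  guard (m * suc k ≤? n) (map (replicate m (suc k) ++_) (boundedPartitions k (n ∸ m * suc k)))

∈-withTopMultiplicity⁻ : ∀ k n m {xs} → xs ∈ withTopMultiplicity k n m →
  m * suc k ≤ n × ∃ λ r → r ∈ boundedPartitions k (n ∸ m * suc k) × xs ≡ replicate m (suc k) ++ r
∈-withTopMultiplicity⁻ k n m xs∈ with ∈-guard⁻ (m * suc k ≤? n) xs∈
... | mK≤n , xs∈′ with ∈-map⁻ (replicate m (suc k) ++_) xs∈′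
... | r , r∈ , xs≡ = mK≤n , r , r∈ , xs≡

boundedPartitions-sound : ∀ k n {xs} → xs ∈ boundedPartitions k n → IsPartition n xs × All (_≤ k) xs
boundedPartitions-sound zero zero (here refl) = ([] , [] , refl) , []
boundedPartitions-sound (suc k) n xs∈ with concatMap-∈⁻ {xs = upTo (suc n)} xs∈
... | m , _ , xs∈′ with ∈-withTopMultiplicity⁻ k n m xs∈′
... | mK≤n , r , r∈ , refl with boundedPartitions-sound k (n ∸ m * suc k) r∈
... | (r-pos , r-linked , r-sum) , r≤k =
  ( AllP.++⁺ (AllP.replicate⁺ m (s≤s z≤n)) r-pos
  , Linked-replicate-++ m (suc k) r≤1+k r-linked
  , trans (sum-++ (replicate m (suc k)) r) (trans (cong₂ _+_ (sum-replicate m (suc k)) r-sum) (m+[n∸m]≡n mK≤n)))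
  , AllP.++⁺ (AllP.replicate⁺ m ≤-refl) r≤1+k
  where r≤1+k = All.map m≤n⇒m≤1+n r≤k

splitTop : ∀ k xs → Linked _≥_ xs → All (_≤ suc k) xs →
           ∃₂ λ m r → xs ≡ replicate m (suc k) ++ r × All (_≤ k) r
splitTop k [] _ _ = 0 , [] , refl , []
splitTop k (x ∷ xs) l (x≤1+k ∷ xs≤1+k) with x ≟ suc k
... | yes refl with splitTop k xs (Linked.tail l) xs≤1+k
...   | m , r , refl , r≤k = suc m , r , refl , r≤k
splitTop k (x ∷ xs) l (x≤1+k ∷ _) | no x≢1+k =
  0 , x ∷ xs , refl , x≤k ∷ All.map (λ y≤x → ≤-trans y≤x x≤k) (Linked⇒All≤head l)
  where x≤k = ≤-pred (≤∧≢⇒< x≤1+k x≢1+k)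

boundedPartitions-complete : ∀ k n {xs} → IsPartition n xs → All (_≤ k) xs → xs ∈ boundedPartitions k n
boundedPartitions-complete zero .0 {[]} (_ , _ , refl) _ = here refl
boundedPartitions-complete zero n {x ∷ xs} (1≤x ∷ _ , _) (x≤0 ∷ _) =
  ⊥-elim (1+n≰n (≤-trans 1≤x x≤0))
boundedPartitions-complete (suc k) n {xs} (pos , linked , sum≡n) xs≤1+k with splitTop k xs linked xs≤1+k
... | m , r , refl , r≤k =
  concatMap-∈⁺ {xs = upTo (suc n)} (∈-upTo⁺ (s≤s m≤n))
    (∈-guard⁺ (m * suc k ≤? n) mK≤n (∈-map⁺ (replicate m (suc k) ++_)
      (boundedPartitions-complete k (n ∸ m * suc k) r-partition r≤k)))
  where
  mK+r≡n : m * suc k + sum r ≡ n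
  mK+r≡n = trans (cong (_+ sum r) (sym (sum-replicate m (suc k))))
                 (trans (sym (sum-++ (replicate m (suc k)) r)) sum≡n)
  mK≤n : m * suc k ≤ n
  mK≤n = subst (m * suc k ≤_) mK+r≡n (m≤m+n _ _)
  m≤n : m ≤ n
  m≤n = ≤-trans (m≤m*n m (suc k)) mK≤n
  r-partition : IsPartition (n ∸ m * suc k) r
  r-partition = AllP.++⁻ʳ (replicate m (suc k)) pos , Linked-++⁻ʳ (replicate m (suc k)) linked ,
                trans (sym (m+n∸m≡n (m * suc k) (sum r))) (cong (_∸ m * suc k) mK+r≡n)

boundedPartitions-unique : ∀ k n → Unique (boundedPartitions k n)
boundedPartitions-unique zero zero = [] ∷ []
boundedPartitions-unique zero (suc n) = []
boundedPartitions-unique (suc k) n =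
  concatMap-unique (λ xs → mult xs (suc k)) (withTopMultiplicity k n) (upTo (suc n)) (UniqueP.upTo⁺ (suc n))
                   blockUnique multiplicityOf
  where
  blockUnique : ∀ m → Unique (withTopMultiplicity k n m)
  blockUnique m = guard-unique (m * suc k ≤? n)
    (UniqueP.map⁺ (λ {a} {b} → ++-cancelˡ (replicate m (suc k)) a b)
                  (boundedPartitions-unique k (n ∸ m * suc k)))
  multiplicityOf : ∀ m xs → xs ∈ withTopMultiplicity k n m → mult xs (suc k) ≡ m
  multiplicityOf m xs xs∈ with ∈-withTopMultiplicity⁻ k n m xs∈
  ... | _ , r , r∈ , refl = mult-replicate-++ m k r (proj₂ (boundedPartitions-sound k _ r∈))

listsOfLength-length : ∀ n L {ys} → ys ∈ listsOfLength n L → length ys ≡ L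
listsOfLength-length n zero (here refl) = refl
listsOfLength-length n (suc L) ys∈ with concatMap-∈⁻ {xs = map suc (upTo n)} ys∈
... | x , _ , ys∈′ with ∈-map⁻ (x ∷_) ys∈′
... | zs , zs∈ , refl = cong suc (listsOfLength-length n L zs∈)

listsOfLength-unique : ∀ n L → Unique (listsOfLength n L)
listsOfLength-unique n zero = [] ∷ []
listsOfLength-unique n (suc L) =
  concatMap-unique head (λ x → map (x ∷_) (listsOfLength n L)) (map suc (upTo n))
    (UniqueP.map⁺ suc-injective (UniqueP.upTo⁺ n))
    (λ x → UniqueP.map⁺ ∷-injectiveʳ (listsOfLength-unique n L)) headOf
  where
  head : List ℕ → ℕ
  head [] = 0
  head (x ∷ _) = x
  headOf : ∀ x ys → ys ∈ map (x ∷_) (listsOfLength n L) → head ys ≡ x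
  headOf x ys ys∈ with ∈-map⁻ (x ∷_) ys∈
  ... | _ , _ , refl = refl

listsOfLength-complete : ∀ n xs → All (λ x → 1 ≤ x × x ≤ n) xs → xs ∈ listsOfLength n (length xs)
listsOfLength-complete n [] _ = here refl
listsOfLength-complete n (suc x ∷ xs) ((_ , 1+x≤n) ∷ bounds) =
  concatMap-∈⁺ {xs = map suc (upTo n)} (∈-map⁺ suc (∈-upTo⁺ 1+x≤n))
    (∈-map⁺ (suc x ∷_) (listsOfLength-complete n xs bounds))

partitions-unique : ∀ n → Unique (partitions n)
partitions-unique n = UniqueP.filter⁺ (isPartition? n)
  (concatMap-unique length (listsOfLength n) (upTo (suc n)) (UniqueP.upTo⁺ (suc n)) (listsOfLength-unique n)
                    (λ L _ → listsOfLength-length n L))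

∈-partitions⁺ : ∀ n {xs} → IsPartition n xs → xs ∈ partitions n
∈-partitions⁺ n {xs} p@(pos , _ , refl) = ∈-filter⁺ (isPartition? n)
  (concatMap-∈⁺ {f = listsOfLength (sum xs)} (∈-upTo⁺ (s≤s (length≤sum xs pos)))
    (listsOfLength-complete (sum xs) xs (All.zip (pos , All≤sum xs)))) p

∈-partitions⁻ : ∀ n {xs} → xs ∈ partitions n → IsPartition n xs
∈-partitions⁻ n {xs} xs∈ = proj₂ (∈-filter⁻ (isPartition? n) {xs = candidates n} xs∈)

-- Parts of a partition of n are at most n.
sum-map-partitions : ∀ (F : List ℕ → ℕ) n → sum (map F (partitions n)) ≡ sum (map F (boundedPartitions n n))
sum-map-partitions F n = sum-map-unique-≡ F (partitions-unique n) (boundedPartitions-unique n n)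
  (λ {xs} xs∈ → let p@(_ , _ , sum≡n) = ∈-partitions⁻ n xs∈
                in boundedPartitions-complete n n p (subst (λ s → All (_≤ s) xs) sum≡n (All≤sum xs)))
  (λ xs∈ → ∈-partitions⁺ n (proj₁ (boundedPartitions-sound n n xs∈)))

multSum : List ℕ → (ℕ → ℕ) → ℕ
multSum xs g = sum (map (λ i → g (mult xs i)) (distinctParts xs))

-- A part of multiplicity m = 0 is absent and contributes nothing.
ifPresent : (ℕ → ℕ) → ℕ → ℕ
ifPresent g zero = 0
ifPresent g (suc m) = g (suc m)

module _ (k : ℕ) where

  private
    K = suc k
    ≢K : ∀ {r} → All (_≤ k) r → ∀ {i} → i ∈ distinctParts r → K ≢ i
    ≢K r≤k i∈ K≡i = All.lookup (All≤⇒All≢suc _ r≤k) (∈-deduplicate⁻ _≟_ _ i∈) (sym K≡i)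

  distinctParts-replicate-++ : ∀ m r → All (_≤ k) r →
                               distinctParts (K ∷ (replicate m K ++ r)) ≡ K ∷ distinctParts r
  distinctParts-replicate-++ zero r r≤k =
    cong (K ∷_) (filter-all (¬? ∘ (K ≟_)) (All.tabulate (≢K r≤k)))
  distinctParts-replicate-++ (suc m) r r≤k = cong (K ∷_) (begin
      filter (¬? ∘ (K ≟_)) (distinctParts (K ∷ (replicate m K ++ r)))
    ≡⟨ cong (filter (¬? ∘ (K ≟_))) (distinctParts-replicate-++ m r r≤k) ⟩
      filter (¬? ∘ (K ≟_)) (K ∷ distinctParts r)
    ≡⟨ filter-reject (¬? ∘ (K ≟_)) (λ K≢K → K≢K refl) ⟩
      filter (¬? ∘ (K ≟_)) (distinctParts r)
    ≡⟨ filter-all (¬? ∘ (K ≟_)) (All.tabulate (≢K r≤k)) ⟩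
      distinctParts r
    ∎)
    where open ≡-Reasoning

  multSum-replicate-++ : ∀ m r → All (_≤ k) r → ∀ g →
                         multSum (replicate m K ++ r) g ≡ ifPresent g m + multSum r g
  multSum-replicate-++ zero r r≤k g = refl
  multSum-replicate-++ (suc m) r r≤k g =
    trans (cong (λ ps → sum (map (λ i → g (mult (replicate (suc m) K ++ r) i)) ps))
                (distinctParts-replicate-++ m r r≤k))
          (cong₂ _+_ (cong g (mult-replicate-++ (suc m) k r r≤k))
                     (sum-map-cong (distinctParts r) (λ i∈ → cong g (multOfLower i∈))))
    where
    multOfLower : ∀ {i} → i ∈ distinctParts r → mult (replicate (suc m) K ++ r) i ≡ mult r i
    multOfLower {i} i∈ = trans (mult-++ (replicate (suc m) K) r i)
      (cong (_+ mult r i) (mult-absent (replicate (suc m) K) i (AllP.replicate⁺ (suc m) (≢K r≤k i∈))))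

odd? : (xs : List ℕ) → Dec (All (λ x → ¬ (2 ∣ x)) xs)
odd? = all? (λ x → ¬? (2 ∣? x))

distinct? : (xs : List ℕ) → Dec (AllPairs (λ a b → ¬ (a ≡ b)) xs)
distinct? = allPairs? (λ a b → ¬? (a ≟ b))

binaryLength : ℕ → ℕ
binaryLength c = ⌊log₂ c ⌋ + 1

isOne isTwo : ℕ → ℕ
isOne v = 𝟙 (v ≟ 1)
isTwo v = 𝟙 (v ≟ 2)

-- Conditions on (#parts occurring twice, #parts occurring once, #distinct parts).
oneTwiceCounts allOnceCounts : ℕ → ℕ → ℕ → ℕ
oneTwiceCounts a b c = 𝟙 (a ≟ 1 ×-dec b + 1 ≟ c)
allOnceCounts a b c = 𝟙 (a ≟ 0 ×-dec b ≟ c)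

byCounts : (ℕ → ℕ → ℕ → ℕ) → List ℕ → ℕ
byCounts P xs = P (multSum xs isTwo) (multSum xs isOne) (multSum xs (λ _ → 1))

odd𝟙 distinct𝟙 bommTotal oddBomm distinctLength oneTwice𝟙 allOnce𝟙 : List ℕ → ℕ
odd𝟙 xs = 𝟙 (odd? xs)
distinct𝟙 xs = 𝟙 (distinct? xs)
bommTotal xs = multSum xs binaryLength
oddBomm xs = odd𝟙 xs * bommTotal xs
distinctLength xs = distinct𝟙 xs * length xs
oneTwice𝟙 = byCounts oneTwiceCounts
allOnce𝟙 = byCounts allOnceCounts

oneTwice𝟙-correct : ∀ xs → 𝟙 (oneTwiceRestOnce? xs) ≡ oneTwice𝟙 xs
oneTwice𝟙-correct xs =
  𝟙-⇔ (oneTwiceRestOnce? xs) (multSum xs isTwo ≟ 1 ×-dec multSum xs isOne + 1 ≟ multSum xs (λ _ → 1))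
    (λ (twice≡1 , once+1≡all) →
      trans (sym #twice) twice≡1 , trans (cong (_+ 1) (sym #once)) (trans once+1≡all #all))
    (λ (twice≡1 , once+1≡all) →
      trans #twice twice≡1 , trans (cong (_+ 1) #once) (trans once+1≡all (sym #all)))
  where
  #twice = length-filter (λ i → mult xs i ≟ 2) (distinctParts xs)
  #once = length-filter (λ i → mult xs i ≟ 1) (distinctParts xs)
  #all = length≡sum-map-1 (distinctParts xs)

once+twice≤all : ∀ xs → multSum xs isOne + multSum xs isTwo ≤ multSum xs (λ _ → 1)
once+twice≤all xs = subst (_≤ multSum xs (λ _ → 1))
  (sum-map-+ (distinctParts xs) (λ i → isOne (mult xs i)) (λ i → isTwo (mult xs i)))
  (sum-map-≤ (distinctParts xs) _ _ (λ i → atMostOneOf (mult xs i)))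
  where
  atMostOneOf : ∀ v → isOne v + isTwo v ≤ 1
  atMostOneOf 0 = z≤n
  atMostOneOf 1 = s≤s z≤n
  atMostOneOf 2 = s≤s z≤n
  atMostOneOf (suc (suc (suc v))) = z≤n

atMostOnce X X² : Series
atMostOnce m = 𝟙 (m ≤? 1)
X m = 𝟙 (m ≟ 1)
X² m = 𝟙 (m ≟ 2)

oddBlock : ℕ → Series
oddBlock K m = 𝟙 (odd? (replicate m K))

oddBlock-odd : ∀ K m → ¬ (2 ∣ K) → oddBlock K m ≡ 1
oddBlock-odd K m 2∤K = 𝟙-yes (odd? (replicate m K)) (AllP.replicate⁺ m 2∤K)

oddBlock-even : ∀ K → 2 ∣ K → oddBlock K ≗ δ
oddBlock-even K 2∣K zero = refl
oddBlock-even K 2∣K (suc m) = 𝟙-no (odd? (replicate (suc m) K)) (λ { (2∤K ∷ _) → 2∤K 2∣K })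

oneTwiceCounts-step : ∀ a b c m → b + a ≤ c →
  oneTwiceCounts (ifPresent isTwo m + a) (ifPresent isOne m + b) (ifPresent (λ _ → 1) m + c)
    ≡ atMostOnce m * oneTwiceCounts a b c + X² m * allOnceCounts a b c
oneTwiceCounts-step a b c 0 _ = sym (trans (+-identityʳ _) (*-identityˡ _))
oneTwiceCounts-step a b c 1 _ = trans
  (𝟙-⇔ (a ≟ 1 ×-dec suc (b + 1) ≟ suc c) (a ≟ 1 ×-dec b + 1 ≟ c)
       (λ (x , y) → x , suc-injective y) (λ (x , y) → x , cong suc y))
  (sym (trans (+-identityʳ _) (*-identityˡ _)))
oneTwiceCounts-step a b c 2 _ = trans
  (𝟙-⇔ (suc a ≟ 1 ×-dec b + 1 ≟ suc c) (a ≟ 0 ×-dec b ≟ c)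
       (λ (x , y) → suc-injective x , suc-injective (trans (+-comm 1 b) y))
       (λ (x , y) → cong suc x , trans (+-comm b 1) (cong suc y)))
  (sym (*-identityˡ _))
oneTwiceCounts-step a b c (suc (suc (suc m))) b+a≤c =
  𝟙-no (a ≟ 1 ×-dec b + 1 ≟ suc c) (λ (x , y) → 1+n≰n (subst (_≤ c) (trans (cong (b +_) x) y) b+a≤c))

allOnceCounts-step : ∀ a b c m → b ≤ c →
  allOnceCounts (ifPresent isTwo m + a) (ifPresent isOne m + b) (ifPresent (λ _ → 1) m + c)
    ≡ atMostOnce m * allOnceCounts a b c
allOnceCounts-step a b c 0 _ = sym (*-identityˡ _)
allOnceCounts-step a b c 1 _ = trans
  (𝟙-⇔ (a ≟ 0 ×-dec suc b ≟ suc c) (a ≟ 0 ×-dec b ≟ c)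
       (λ (x , y) → x , suc-injective y) (λ (x , y) → x , cong suc y))
  (sym (*-identityˡ _))
allOnceCounts-step a b c 2 _ = 𝟙-no (suc a ≟ 0 ×-dec b ≟ suc c) (λ (x , _) → 1+n≢0 x)
allOnceCounts-step a b c (suc (suc (suc m))) b≤c =
  𝟙-no (a ≟ 0 ×-dec b ≟ suc c) (λ (_ , y) → 1+n≰n (subst (_≤ c) y b≤c))

module _ (k : ℕ) where

  private
    K = suc k

  odd𝟙-replicate-++ : ∀ m r → odd𝟙 (replicate m K ++ r) ≡ oddBlock K m * odd𝟙 r
  odd𝟙-replicate-++ m r = trans
    (𝟙-⇔ (odd? (replicate m K ++ r)) (odd? (replicate m K) ×-dec odd? r)
         (λ p → AllP.++⁻ˡ (replicate m K) p , AllP.++⁻ʳ (replicate m K) p) (λ (p , q) → AllP.++⁺ p q))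
    (𝟙-× (odd? (replicate m K)) (odd? r))

  distinct𝟙-replicate-++ : ∀ m r → All (_≤ k) r → distinct𝟙 (replicate m K ++ r) ≡ atMostOnce m * distinct𝟙 r
  distinct𝟙-replicate-++ m r r≤k =
    trans (𝟙-⇔ (distinct? (replicate m K ++ r)) (m ≤? 1 ×-dec distinct? r) (split m) (join m))
          (𝟙-× (m ≤? 1) (distinct? r))
    where
    Distinct = AllPairs (λ a b → ¬ (a ≡ b))
    split : ∀ m → Distinct (replicate m K ++ r) → m ≤ 1 × Distinct r
    split 0 p = z≤n , p
    split 1 (_ ∷ p) = s≤s z≤n , p
    split (suc (suc m)) (K≢ ∷ _) = ⊥-elim (All.head K≢ refl)
    join : ∀ m → m ≤ 1 × Distinct r → Distinct (replicate m K ++ r)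
    join 0 (_ , p) = p
    join 1 (_ , p) = All.map (_∘ sym) (All≤⇒All≢suc r r≤k) ∷ p
    join (suc (suc m)) (s≤s () , _)

  oddBomm-replicate-++ : ∀ m r → All (_≤ k) r →
    oddBomm (replicate m K ++ r) ≡ (oddBlock K m * ifPresent binaryLength m) * odd𝟙 r + oddBlock K m * oddBomm r
  oddBomm-replicate-++ m r r≤k = trans
    (cong₂ _*_ (odd𝟙-replicate-++ m r) (multSum-replicate-++ k m r r≤k binaryLength))
    (solve 4 (λ c f g p → (c :* f) :* (g :+ p) := (c :* g) :* f :+ c :* (f :* p)) refl
             (oddBlock K m) (odd𝟙 r) (ifPresent binaryLength m) (bommTotal r))
    where open +-*-Solver

  distinctLength-replicate-++ : ∀ m r → All (_≤ k) r →
    distinctLength (replicate m K ++ r) ≡ X m * distinct𝟙 r + atMostOnce m * distinctLength r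
  distinctLength-replicate-++ m r r≤k = begin
      distinctLength (replicate m K ++ r)
    ≡⟨ cong₂ _*_ (distinct𝟙-replicate-++ m r r≤k)
                 (trans (length-++ (replicate m K)) (cong (_+ length r) (length-replicate m))) ⟩
      atMostOnce m * distinct𝟙 r * (m + length r)
    ≡⟨ solve 4 (λ i f m l → (i :* f) :* (m :+ l) := (i :* m) :* f :+ i :* (f :* l)) refl
               (atMostOnce m) (distinct𝟙 r) m (length r) ⟩
      atMostOnce m * m * distinct𝟙 r + atMostOnce m * distinctLength r
    ≡⟨ cong (λ z → z * distinct𝟙 r + atMostOnce m * distinctLength r) (atMostOnce*id m) ⟩
      X m * distinct𝟙 r + atMostOnce m * distinctLength r
    ∎
    where
    open ≡-Reasoning
    open +-*-Solver
    atMostOnce*id : ∀ m → atMostOnce m * m ≡ X m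
    atMostOnce*id 0 = refl
    atMostOnce*id 1 = refl
    atMostOnce*id (suc (suc m)) = refl

  byCounts-replicate-++ : ∀ P m r → All (_≤ k) r →
    byCounts P (replicate m K ++ r) ≡ P (ifPresent isTwo m + multSum r isTwo) (ifPresent isOne m + multSum r isOne)
                                        (ifPresent (λ _ → 1) m + multSum r (λ _ → 1))
  byCounts-replicate-++ P m r r≤k
    rewrite multSum-replicate-++ k m r r≤k isTwo | multSum-replicate-++ k m r r≤k isOne
          | multSum-replicate-++ k m r r≤k (λ _ → 1) = refl

  oneTwice𝟙-replicate-++ : ∀ m r → All (_≤ k) r →
    oneTwice𝟙 (replicate m K ++ r) ≡ atMostOnce m * oneTwice𝟙 r + X² m * allOnce𝟙 r
  oneTwice𝟙-replicate-++ m r r≤k = trans (byCounts-replicate-++ oneTwiceCounts m r r≤k)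
    (oneTwiceCounts-step _ _ _ m (once+twice≤all r))

  allOnce𝟙-replicate-++ : ∀ m r → All (_≤ k) r → allOnce𝟙 (replicate m K ++ r) ≡ atMostOnce m * allOnce𝟙 r
  allOnce𝟙-replicate-++ m r r≤k = trans (byCounts-replicate-++ allOnceCounts m r r≤k)
    (allOnceCounts-step _ _ _ m (≤-trans (m≤m+n _ _) (once+twice≤all r)))

-- Generating functions

gf : (List ℕ → ℕ) → ℕ → Series
gf F k n = sum (map F (boundedPartitions k n))

gf-zero : ∀ F → gf F 0 ≗ λ n → F [] * δ n
gf-zero F zero = trans (+-identityʳ (F [])) (sym (*-identityʳ (F [])))
gf-zero F (suc n) = sym (*-zeroʳ (F []))

-- Adding the part K = 1 + k with multiplicity m multiplies by the monomial x^(m K).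
gf-step : ∀ k (F G H : List ℕ → ℕ) (c d : Series) →
  (∀ m r → All (_≤ k) r → F (replicate m (suc k) ++ r) ≡ c m * G r + d m * H r) →
  gf F (suc k) ≗ dilate (suc k) c ⋆ gf G k ⊕ dilate (suc k) d ⋆ gf H k
gf-step k F G H c d decompose n = begin
    sum (map F (concatMap (withTopMultiplicity k n) (upTo (suc n))))
  ≡⟨ sum-map-concatMap F (withTopMultiplicity k n) (upTo (suc n)) ⟩
    sum (map (λ m → sum (map F (withTopMultiplicity k n m))) (upTo (suc n)))
  ≡⟨ sum-map-upTo n _ ⟩
    sumTo n (λ m → sum (map F (withTopMultiplicity k n m)))
  ≡⟨ sumTo-ext n blockSum ⟩
    sumTo n (λ m → term c G m + term d H m)
  ≡⟨ sumTo-+ n _ _ ⟩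
    sumTo n (term c G) + sumTo n (term d H)
  ≡⟨ cong₂ _+_ (dilate-⋆ K c (gf G k) n) (dilate-⋆ K d (gf H k) n) ⟨
    (dilate K c ⋆ gf G k ⊕ dilate K d ⋆ gf H k) n
  ∎
  where
  open ≡-Reasoning
  K = suc k
  term : Series → (List ℕ → ℕ) → ℕ → ℕ
  term e G m = 𝟙 (m * K ≤? n) * (e m * gf G k (n ∸ m * K))
  blockSum : ∀ m → sum (map F (withTopMultiplicity k n m)) ≡ term c G m + term d H m
  blockSum m = begin
      sum (map F (withTopMultiplicity k n m))
    ≡⟨ sum-map-guard (m * K ≤? n) F _ ⟩
      𝟙 (m * K ≤? n) * sum (map F (map (replicate m K ++_) rs))
    ≡⟨ cong (𝟙 (m * K ≤? n) *_) (cong sum (map-∘ rs)) ⟨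
      𝟙 (m * K ≤? n) * sum (map (F ∘ (replicate m K ++_)) rs)
    ≡⟨ cong (𝟙 (m * K ≤? n) *_) (sum-map-cong rs λ r∈ → decompose m _ (proj₂ (boundedPartitions-sound k _ r∈))) ⟩
      𝟙 (m * K ≤? n) * sum (map (λ r → c m * G r + d m * H r) rs)
    ≡⟨ cong (𝟙 (m * K ≤? n) *_)
            (trans (sum-map-+ rs _ _) (cong₂ _+_ (sum-map-*ˡ rs (c m) G) (sum-map-*ˡ rs (d m) H))) ⟩
      𝟙 (m * K ≤? n) * (c m * gf G k (n ∸ m * K) + d m * gf H k (n ∸ m * K))
    ≡⟨ *-distribˡ-+ (𝟙 (m * K ≤? n)) _ _ ⟩
      term c G m + term d H m
    ∎
    where rs = boundedPartitions k (n ∸ m * K)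

gf-step₁ : ∀ k (F G : List ℕ → ℕ) (c : Series) →
  (∀ m r → All (_≤ k) r → F (replicate m (suc k) ++ r) ≡ c m * G r) →
  gf F (suc k) ≗ dilate (suc k) c ⋆ gf G k
gf-step₁ k F G c decompose n = begin
    gf F (suc k) n
  ≡⟨ gf-step k F G G c 0ₛ (λ m r r≤k → trans (decompose m r r≤k) (sym (+-identityʳ _))) n ⟩
    (dilate (suc k) c ⋆ gf G k) n + (dilate (suc k) 0ₛ ⋆ gf G k) n
  ≡⟨ cong ((dilate (suc k) c ⋆ gf G k) n +_)
          (trans (⋆-congˡ (gf G k) (dilate-0ₛ (suc k)) n) (⋆-zeroˡ (gf G k) n)) ⟩
    (dilate (suc k) c ⋆ gf G k) n + 0
  ≡⟨ +-identityʳ _ ⟩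
    (dilate (suc k) c ⋆ gf G k) n
  ∎
  where open ≡-Reasoning

𝒪 𝒟 𝒜 ℬ 𝒞 𝒯 : ℕ → Series
𝒪 = gf odd𝟙
𝒟 = gf distinct𝟙
𝒜 = gf oddBomm
ℬ = gf distinctLength
𝒞 = gf oneTwice𝟙
𝒯 = gf allOnce𝟙

bommBlock : ℕ → Series
bommBlock K m = oddBlock K m * ifPresent binaryLength m

𝒪-step : ∀ k → 𝒪 (suc k) ≗ dilate (suc k) (oddBlock (suc k)) ⋆ 𝒪 k
𝒪-step k = gf-step₁ k odd𝟙 odd𝟙 (oddBlock (suc k)) (λ m r _ → odd𝟙-replicate-++ k m r)

𝒟-step : ∀ k → 𝒟 (suc k) ≗ dilate (suc k) atMostOnce ⋆ 𝒟 k
𝒟-step k = gf-step₁ k distinct𝟙 distinct𝟙 atMostOnce (distinct𝟙-replicate-++ k)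

𝒯-step : ∀ k → 𝒯 (suc k) ≗ dilate (suc k) atMostOnce ⋆ 𝒯 k
𝒯-step k = gf-step₁ k allOnce𝟙 allOnce𝟙 atMostOnce (allOnce𝟙-replicate-++ k)

𝒜-step : ∀ k →
  𝒜 (suc k) ≗ dilate (suc k) (bommBlock (suc k)) ⋆ 𝒪 k ⊕ dilate (suc k) (oddBlock (suc k)) ⋆ 𝒜 k
𝒜-step k = gf-step k oddBomm odd𝟙 oddBomm (bommBlock (suc k)) (oddBlock (suc k)) (oddBomm-replicate-++ k)

ℬ-step : ∀ k → ℬ (suc k) ≗ dilate (suc k) X ⋆ 𝒟 k ⊕ dilate (suc k) atMostOnce ⋆ ℬ k
ℬ-step k = gf-step k distinctLength distinct𝟙 distinctLength X atMostOnce (distinctLength-replicate-++ k)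

𝒞-step : ∀ k → 𝒞 (suc k) ≗ dilate (suc k) atMostOnce ⋆ 𝒞 k ⊕ dilate (suc k) X² ⋆ 𝒯 k
𝒞-step k = gf-step k oneTwice𝟙 oneTwice𝟙 allOnce𝟙 atMostOnce X² (oneTwice𝟙-replicate-++ k)

𝒯≗𝒟 : ∀ k → 𝒯 k ≗ 𝒟 k
𝒯≗𝒟 zero n = trans (gf-zero allOnce𝟙 n) (sym (gf-zero distinct𝟙 n))
𝒯≗𝒟 (suc k) n =
  trans (𝒯-step k n) (trans (⋆-congʳ (dilate (suc k) atMostOnce) (𝒯≗𝒟 k) n) (sym (𝒟-step k n)))

-- Euler's partition theorem

geometric : ℕ → Series
geometric K = dilate K ones

∏geometric ∏geometricEven : ℕ → Series
∏geometric zero = δ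
∏geometric (suc k) = geometric (suc k) ⋆ ∏geometric k
∏geometricEven zero = δ
∏geometricEven (suc k) = geometric (suc k * 2) ⋆ ∏geometricEven k

geometric2-even : ∀ t → geometric 2 (t * 2) ≡ 1
geometric2-even t =
  trans (sumTo-single (t * 2) t (m≤m*n t 2) others) (trans (*-identityʳ _) (𝟙-yes (t * 2 ≟ t * 2) refl))
  where
  others : ∀ i → i ≤ t * 2 → i ≢ t → 𝟙 (i * 2 ≟ t * 2) * 1 ≡ 0
  others i _ i≢t = trans (*-identityʳ _) (𝟙-no (i * 2 ≟ t * 2) (i≢t ∘ *-cancelʳ-≡ i t 2))

geometric2-odd : ∀ t → geometric 2 (suc (t * 2)) ≡ 0
geometric2-odd t = sumTo-zero (suc (t * 2)) λ i _ →
  trans (*-identityʳ _) (𝟙-no (i * 2 ≟ suc (t * 2)) (m*2≢1+n*2 i t))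

atMostOnce⋆geometric2 : atMostOnce ⋆ geometric 2 ≗ ones
atMostOnce⋆geometric2 zero = refl
atMostOnce⋆geometric2 (suc m) = begin
    sumTo (suc m) (λ i → atMostOnce i * geometric 2 (suc m ∸ i))
  ≡⟨ sumTo-sucˡ m _ ⟩
    geometric 2 (suc m) + 0 + sumTo m (λ i → atMostOnce (suc i) * geometric 2 (m ∸ i))
  ≡⟨ cong₂ _+_ (+-identityʳ _) (trans (sumTo-single m 0 z≤n onlyFirst) (+-identityʳ _)) ⟩
    geometric 2 (suc m) + geometric 2 m
  ≡⟨ consecutive (evenOrOdd m) ⟩
    1
  ∎
  where
  open ≡-Reasoning
  onlyFirst : ∀ i → i ≤ m → i ≢ 0 → atMostOnce (suc i) * geometric 2 (m ∸ i) ≡ 0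
  onlyFirst zero _ 0≢0 = ⊥-elim (0≢0 refl)
  onlyFirst (suc i) _ _ = refl
  consecutive : ∀ {m} → EvenOrOdd m → geometric 2 (suc m) + geometric 2 m ≡ 1
  consecutive (even t) = cong₂ _+_ (geometric2-odd t) (geometric2-even t)
  consecutive (odd t) = cong₂ _+_ (geometric2-even (suc t)) (geometric2-odd t)

dilate-atMostOnce⋆geometric : ∀ K .{{_ : NonZero K}} → dilate K atMostOnce ⋆ geometric (K * 2) ≗ geometric K
dilate-atMostOnce⋆geometric K n = begin
    (dilate K atMostOnce ⋆ geometric (K * 2)) n
  ≡⟨ ⋆-congʳ (dilate K atMostOnce) (dilate-* K 2 ones) n ⟩
    (dilate K atMostOnce ⋆ dilate K (geometric 2)) n
  ≡⟨ dilate-⋆-dilate K atMostOnce (geometric 2) n ⟩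
    dilate K (atMostOnce ⋆ geometric 2) n
  ≡⟨ dilate-cong K atMostOnce⋆geometric2 n ⟩
    geometric K n
  ∎
  where open ≡-Reasoning

𝒟⋆∏geometricEven : ∀ N → 𝒟 N ⋆ ∏geometricEven N ≗ ∏geometric N
𝒟⋆∏geometricEven zero n =
  trans (⋆-identityʳ (𝒟 0) n) (trans (gf-zero distinct𝟙 n) (*-identityˡ (δ n)))
𝒟⋆∏geometricEven (suc k) n = begin
    (𝒟 K ⋆ ∏geometricEven K) n
  ≡⟨ ⋆-congˡ (∏geometricEven K) (𝒟-step k) n ⟩
    ((dilate K atMostOnce ⋆ 𝒟 k) ⋆ (geometric (K * 2) ⋆ ∏geometricEven k)) n
  ≡⟨ ⋆-interchange (dilate K atMostOnce) (𝒟 k) (geometric (K * 2)) (∏geometricEven k) n ⟩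
    ((dilate K atMostOnce ⋆ geometric (K * 2)) ⋆ (𝒟 k ⋆ ∏geometricEven k)) n
  ≡⟨ ⋆-cong (dilate-atMostOnce⋆geometric K) (𝒟⋆∏geometricEven k) n ⟩
    ∏geometric K n
  ∎
  where
  open ≡-Reasoning
  K = suc k

𝒪-step-odd : ∀ M → 𝒪 (suc (M * 2)) ≗ geometric (suc (M * 2)) ⋆ 𝒪 (M * 2)
𝒪-step-odd M n = trans (𝒪-step (M * 2) n)
  (⋆-congˡ (𝒪 (M * 2)) (dilate-cong (suc (M * 2)) (λ m → oddBlock-odd (suc (M * 2)) m (2∤1+n*2 M))) n)

𝒪-step-even : ∀ M → 𝒪 (suc M * 2) ≗ 𝒪 (suc (M * 2))
𝒪-step-even M n = begin
    𝒪 (suc M * 2) n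
  ≡⟨ 𝒪-step (suc (M * 2)) n ⟩
    (dilate K (oddBlock K) ⋆ 𝒪 (suc (M * 2))) n
  ≡⟨ ⋆-congˡ (𝒪 (suc (M * 2)))
             (λ j → trans (dilate-cong K (oddBlock-even K (divides (suc M) refl)) j) (dilate-δ K j)) n ⟩
    (δ ⋆ 𝒪 (suc (M * 2))) n
  ≡⟨ ⋆-identityˡ (𝒪 (suc (M * 2))) n ⟩
    𝒪 (suc (M * 2)) n
  ∎
  where
  open ≡-Reasoning
  K = suc M * 2

∏geometric-even : ∀ M → ∏geometric (M * 2) ≗ 𝒪 (M * 2) ⋆ ∏geometricEven M
∏geometric-odd : ∀ M → ∏geometric (suc (M * 2)) ≗ 𝒪 (suc (M * 2)) ⋆ ∏geometricEven M
∏geometric-even zero n = sym (trans (⋆-identityʳ (𝒪 0) n) (trans (gf-zero odd𝟙 n) (*-identityˡ (δ n))))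
∏geometric-even (suc M) n = begin
    (geometric K ⋆ ∏geometric (suc (M * 2))) n
  ≡⟨ ⋆-congʳ (geometric K) (∏geometric-odd M) n ⟩
    (geometric K ⋆ (𝒪 (suc (M * 2)) ⋆ ∏geometricEven M)) n
  ≡⟨ ⋆-assoc (geometric K) (𝒪 (suc (M * 2))) (∏geometricEven M) n ⟨
    (geometric K ⋆ 𝒪 (suc (M * 2)) ⋆ ∏geometricEven M) n
  ≡⟨ ⋆-comm-right (geometric K) (𝒪 (suc (M * 2))) (∏geometricEven M) n ⟩
    (geometric K ⋆ ∏geometricEven M ⋆ 𝒪 (suc (M * 2))) n
  ≡⟨ ⋆-comm (∏geometricEven (suc M)) (𝒪 (suc (M * 2))) n ⟩
    (𝒪 (suc (M * 2)) ⋆ ∏geometricEven (suc M)) n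
  ≡⟨ ⋆-congˡ (∏geometricEven (suc M)) (𝒪-step-even M) n ⟨
    (𝒪 K ⋆ ∏geometricEven (suc M)) n
  ∎
  where
  open ≡-Reasoning
  K = suc M * 2
∏geometric-odd M n = begin
    (geometric K ⋆ ∏geometric (M * 2)) n
  ≡⟨ ⋆-congʳ (geometric K) (∏geometric-even M) n ⟩
    (geometric K ⋆ (𝒪 (M * 2) ⋆ ∏geometricEven M)) n
  ≡⟨ ⋆-assoc (geometric K) (𝒪 (M * 2)) (∏geometricEven M) n ⟨
    (geometric K ⋆ 𝒪 (M * 2) ⋆ ∏geometricEven M) n
  ≡⟨ ⋆-congˡ (∏geometricEven M) (𝒪-step-odd M) n ⟨
    (𝒪 K ⋆ ∏geometricEven M) n
  ∎
  where
  open ≡-Reasoning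
  K = suc (M * 2)

∏geometricEven-stable : ∀ M d T → T < suc M * 2 → ∏geometricEven (M + d) ≈[ T ] ∏geometricEven M
∏geometricEven-stable M zero T _ rewrite +-identityʳ M = λ _ _ → refl
∏geometricEven-stable M (suc d) T T<2M+2 rewrite +-suc M d =
  ≈-trans {∏geometricEven (suc (M + d))} {∏geometricEven (M + d)} {∏geometricEven M} T
    (λ n n≤T → trans (⋆-comm (geometric K) (∏geometricEven (M + d)) n)
                     (⋆-identityʳ-≈ (∏geometricEven (M + d)) (geometric K) T geometricK≈δ n n≤T))
    (∏geometricEven-stable M d T T<2M+2)
  where
  K = suc (M + d) * 2
  geometricK≈δ : geometric K ≈[ T ] δ
  geometricK≈δ zero _ = refl
  geometricK≈δ (suc j) 1+j≤T = dilate-gap K ones (suc j) (s≤s z≤n)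
    (≤-<-trans 1+j≤T (<-≤-trans T<2M+2 (*-monoˡ-≤ 2 (s≤s (m≤m+n M d)))))

∏geometricEven-0 : ∀ k → ∏geometricEven k 0 ≡ 1
∏geometricEven-0 zero = refl
∏geometricEven-0 (suc k) = cong (1 *_) (∏geometricEven-0 k)

𝒟≈𝒪-via : ∀ N M → M ≤ N → N < suc M * 2 → ∏geometric N ≗ 𝒪 N ⋆ ∏geometricEven M →
           𝒟 N ≈[ N ] 𝒪 N
𝒟≈𝒪-via N M M≤N N<2M+2 ∏geometric≗ =
  ⋆-cancelʳ-≈ (∏geometricEven M) N (∏geometricEven-0 M) λ n n≤N → begin
    (𝒟 N ⋆ ∏geometricEven M) n
  ≡⟨ ⋆-cong-≈ {𝒟 N} {𝒟 N} N (λ _ _ → refl) (λ j j≤N → sym (stable j j≤N)) n n≤N ⟩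
    (𝒟 N ⋆ ∏geometricEven N) n
  ≡⟨ 𝒟⋆∏geometricEven N n ⟩
    ∏geometric N n
  ≡⟨ ∏geometric≗ n ⟩
    (𝒪 N ⋆ ∏geometricEven M) n
  ∎
  where
  open ≡-Reasoning
  stable : ∏geometricEven N ≈[ N ] ∏geometricEven M
  stable = subst (λ L → ∏geometricEven L ≈[ N ] ∏geometricEven M) (m+[n∸m]≡n M≤N)
                 (∏geometricEven-stable M (N ∸ M) N N<2M+2)

𝒟≈𝒪 : ∀ N → 𝒟 N ≈[ N ] 𝒪 N
𝒟≈𝒪 N with evenOrOdd N
... | even M = 𝒟≈𝒪-via (M * 2) M (m≤m*n M 2) (≤-trans (n<1+n (M * 2)) (n≤1+n _)) (∏geometric-even M)
... | odd M = 𝒟≈𝒪-via (suc (M * 2)) M (≤-trans (m≤m*n M 2) (n≤1+n _)) ≤-refl (∏geometric-odd M)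

-- Length and c₂ over distinct parts

sum₁ : ℕ → (ℕ → ℕ) → ℕ
sum₁ zero g = 0
sum₁ (suc N) g = sum₁ N g + g (suc N)

sum₁-zero : ∀ g N → (∀ K → 1 ≤ K → K ≤ N → g K ≡ 0) → sum₁ N g ≡ 0
sum₁-zero g zero _ = refl
sum₁-zero g (suc N) h =
  cong₂ _+_ (sum₁-zero g N (λ K 1≤K K≤N → h K 1≤K (m≤n⇒m≤1+n K≤N))) (h (suc N) (s≤s z≤n) ≤-refl)

sum₁-single : ∀ g N x → 1 ≤ x → x ≤ N → (∀ K → 1 ≤ K → K ≤ N → K ≢ x → g K ≡ 0) → sum₁ N g ≡ g x
sum₁-single g zero x 1≤x x≤0 _ = ⊥-elim (1+n≰n (≤-trans 1≤x x≤0))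
sum₁-single g (suc N) x 1≤x x≤1+N h with x ≟ suc N
... | yes refl =
  cong (_+ g (suc N)) (sum₁-zero g N (λ K 1≤K K≤N → h K 1≤K (m≤n⇒m≤1+n K≤N) (λ { refl → 1+n≰n K≤N })))
... | no x≢1+N =
  trans (cong₂ _+_ (sum₁-single g N x 1≤x (≤-pred (≤∧≢⇒< x≤1+N x≢1+N)) (λ K 1≤K K≤N → h K 1≤K (m≤n⇒m≤1+n K≤N)))
                   (h (suc N) (s≤s z≤n) ≤-refl (x≢1+N ∘ sym)))
        (+-identityʳ _)

sum₁-cong : ∀ g h N → (∀ K → 1 ≤ K → K ≤ N → g K ≡ h K) → sum₁ N g ≡ sum₁ N h
sum₁-cong g h zero _ = refl
sum₁-cong g h (suc N) g≡h =
  cong₂ _+_ (sum₁-cong g h N (λ K 1≤K K≤N → g≡h K 1≤K (m≤n⇒m≤1+n K≤N))) (g≡h (suc N) (s≤s z≤n) ≤-refl)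

powersUpTo : ℕ → Series
powersUpTo N j = sum₁ N (λ K → dilate K X j)

dilate-X : ∀ K j → dilate K X (suc j) ≡ 𝟙 (K ≟ suc j)
dilate-X K j = trans (sumTo-single (suc j) 1 (s≤s z≤n) others)
                     (trans (*-identityʳ _) (cong (λ z → 𝟙 (z ≟ suc j)) (*-identityˡ K)))
  where
  others : ∀ m → m ≤ suc j → m ≢ 1 → 𝟙 (m * K ≟ suc j) * X m ≡ 0
  others zero _ _ = refl
  others (suc zero) _ 1≢1 = ⊥-elim (1≢1 refl)
  others (suc (suc m)) _ _ = *-zeroʳ (𝟙 (suc (suc m) * K ≟ suc j))

powersUpTo-coeff : ∀ N j → j ≤ N → powersUpTo N j ≡ 𝟙 (1 ≤? j)
powersUpTo-coeff N zero _ = sum₁-zero _ N (λ _ _ _ → refl)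
powersUpTo-coeff N (suc j) 1+j≤N = trans
  (sum₁-single _ N (suc j) (s≤s z≤n) 1+j≤N λ K _ _ K≢1+j → trans (dilate-X K j) (𝟙-no (K ≟ suc j) K≢1+j))
  (trans (dilate-X (suc j) j) (𝟙-yes (suc j ≟ suc j) refl))

X⊕X²≗atMostOnce⋆X : X ⊕ X² ≗ atMostOnce ⋆ X
X⊕X²≗atMostOnce⋆X 0 = refl
X⊕X²≗atMostOnce⋆X 1 = refl
X⊕X²≗atMostOnce⋆X 2 = refl
X⊕X²≗atMostOnce⋆X (suc (suc (suc m))) = sym (sumTo-zero (3 + m) (λ i _ → vanish i))
  where
  vanish : ∀ i → atMostOnce i * X (3 + m ∸ i) ≡ 0
  vanish 0 = refl
  vanish 1 = refl
  vanish (suc (suc i)) = refl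

ℬ⊕𝒞≗𝒟⋆powersUpTo : ∀ k → ℬ k ⊕ 𝒞 k ≗ 𝒟 k ⋆ powersUpTo k
ℬ⊕𝒞≗𝒟⋆powersUpTo zero n =
  trans (cong₂ _+_ (gf-zero distinctLength n) (gf-zero oneTwice𝟙 n)) (sym (⋆-zeroʳ (𝒟 0) n))
ℬ⊕𝒞≗𝒟⋆powersUpTo (suc k) n = begin
    ℬ K n + 𝒞 K n
  ≡⟨ cong₂ _+_ (ℬ-step k n) (𝒞-step k n) ⟩
    (xPart + ℬPart) + (𝒞Part + x²Part)
  ≡⟨ cong (_+ (𝒞Part + x²Part)) (+-comm xPart ℬPart) ⟩
    (ℬPart + xPart) + (𝒞Part + x²Part)
  ≡⟨ +-interchange ℬPart xPart 𝒞Part x²Part ⟩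
    (ℬPart + 𝒞Part) + (xPart + x²Part)
  ≡⟨ cong₂ _+_ unchanged new ⟩
    (𝒟 K ⋆ powersUpTo k) n + (𝒟 K ⋆ dilate K X) n
  ≡⟨ ⋆-distribˡ-⊕ (𝒟 K) (powersUpTo k) (dilate K X) n ⟨
    (𝒟 K ⋆ powersUpTo K) n
  ∎
  where
  open ≡-Reasoning
  K = suc k
  xPart = (dilate K X ⋆ 𝒟 k) n
  x²Part = (dilate K X² ⋆ 𝒯 k) n
  ℬPart = (dilate K atMostOnce ⋆ ℬ k) n
  𝒞Part = (dilate K atMostOnce ⋆ 𝒞 k) n
  unchanged : ℬPart + 𝒞Part ≡ (𝒟 K ⋆ powersUpTo k) n
  unchanged = begin
      ℬPart + 𝒞Part
    ≡⟨ ⋆-distribˡ-⊕ (dilate K atMostOnce) (ℬ k) (𝒞 k) n ⟨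
      (dilate K atMostOnce ⋆ (ℬ k ⊕ 𝒞 k)) n
    ≡⟨ ⋆-congʳ (dilate K atMostOnce) (ℬ⊕𝒞≗𝒟⋆powersUpTo k) n ⟩
      (dilate K atMostOnce ⋆ (𝒟 k ⋆ powersUpTo k)) n
    ≡⟨ ⋆-assoc (dilate K atMostOnce) (𝒟 k) (powersUpTo k) n ⟨
      (dilate K atMostOnce ⋆ 𝒟 k ⋆ powersUpTo k) n
    ≡⟨ ⋆-congˡ (powersUpTo k) (𝒟-step k) n ⟨
      (𝒟 K ⋆ powersUpTo k) n
    ∎
  new : xPart + x²Part ≡ (𝒟 K ⋆ dilate K X) n
  new = begin
      xPart + x²Part
    ≡⟨ cong (xPart +_) (⋆-congʳ (dilate K X²) (𝒯≗𝒟 k) n) ⟩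
      (dilate K X ⋆ 𝒟 k) n + (dilate K X² ⋆ 𝒟 k) n
    ≡⟨ ⋆-distribʳ-⊕ (𝒟 k) (dilate K X) (dilate K X²) n ⟨
      ((dilate K X ⊕ dilate K X²) ⋆ 𝒟 k) n
    ≡⟨ ⋆-congˡ (𝒟 k) (dilate-⊕ K X X²) n ⟨
      (dilate K (X ⊕ X²) ⋆ 𝒟 k) n
    ≡⟨ ⋆-congˡ (𝒟 k) (dilate-cong K X⊕X²≗atMostOnce⋆X) n ⟩
      (dilate K (atMostOnce ⋆ X) ⋆ 𝒟 k) n
    ≡⟨ ⋆-congˡ (𝒟 k) (dilate-⋆-dilate K atMostOnce X) n ⟨
      (dilate K atMostOnce ⋆ dilate K X ⋆ 𝒟 k) n
    ≡⟨ ⋆-comm-right (dilate K atMostOnce) (dilate K X) (𝒟 k) n ⟩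
      (dilate K atMostOnce ⋆ 𝒟 k ⋆ dilate K X) n
    ≡⟨ ⋆-congˡ (dilate K X) (𝒟-step k) n ⟨
      (𝒟 K ⋆ dilate K X) n
    ∎

-- Binary lengths over odd parts

bitLength : ℕ → ℕ
bitLength = ifPresent binaryLength

-- isPow2 m = 1 exactly when m is a power of 2; defined as the jumps of bitLength, so that it telescopes.
isPow2 : Series
isPow2 zero = 0
isPow2 (suc m) = bitLength (suc m) ∸ bitLength m

bitLength-suc : ∀ m → bitLength m ≤ bitLength (suc m)
bitLength-suc zero = z≤n
bitLength-suc (suc m) = +-monoˡ-≤ 1 (⌊log₂⌋-mono-≤ (n≤1+n (suc m)))

sumTo-isPow2 : ∀ m → sumTo m isPow2 ≡ bitLength m
sumTo-isPow2 zero = refl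
sumTo-isPow2 (suc m) = trans (cong (_+ isPow2 (suc m)) (sumTo-isPow2 m)) (m+[n∸m]≡n (bitLength-suc m))

bitLength-double : ∀ i → bitLength (suc i * 2) ≡ suc (bitLength (suc i))
bitLength-double i =
  cong (_+ 1) (trans (cong ⌊log₂_⌋ (*-comm (suc i) 2)) (⌊log₂[2*b]⌋≡1+⌊log₂b⌋ (suc i)))

bitLength-double+1 : ∀ i → bitLength (suc (suc i * 2)) ≡ suc (bitLength (suc i))
bitLength-double+1 i = cong (_+ 1) (begin
    ⌊log₂ n ⌋                 ≡⟨ m+[n∸m]≡n 1≤log₂n ⟨
    suc (⌊log₂ n ⌋ ∸ 1)       ≡⟨ cong suc (⌊log₂⌊n/2⌋⌋≡⌊log₂n⌋∸1 n) ⟨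
    suc ⌊log₂ ⌊ n /2⌋ ⌋       ≡⟨ cong (λ h → suc ⌊log₂ suc h ⌋) (half i) ⟩
    suc ⌊log₂ suc i ⌋         ∎)
  where
  open ≡-Reasoning
  n = suc (suc i * 2)
  1≤log₂n : 1 ≤ ⌊log₂ n ⌋
  1≤log₂n = ⌊log₂⌋-mono-≤ {2} {n} (s≤s (s≤s z≤n))
  half : ∀ m → ⌊ suc (m * 2) /2⌋ ≡ m
  half zero = refl
  half (suc m) = cong suc (half m)

isPow2-odd : ∀ i → isPow2 (suc (suc i * 2)) ≡ 0
isPow2-odd i = trans (cong₂ _∸_ (bitLength-double+1 i) (bitLength-double i)) (n∸n≡0 (suc (bitLength (suc i))))

isPow2-double : ∀ i → isPow2 (i * 2) ≡ isPow2 i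
isPow2-double zero = refl
isPow2-double (suc zero) = refl
isPow2-double (suc (suc i)) = cong₂ _∸_ (bitLength-double (suc i)) (bitLength-double+1 i)

oddPow2 : ℕ → Series
oddPow2 K m = 𝟙 (¬? (2 ∣? K)) * isPow2 m

oddPow2-even : ∀ s → oddPow2 (s * 2) ≗ 0ₛ
oddPow2-even s m = cong (_* isPow2 m) (𝟙-no (¬? (2 ∣? s * 2)) (λ 2∤ → 2∤ (divides s refl)))

dilate-oddPow2-even : ∀ s → dilate (s * 2) (oddPow2 (s * 2)) ≗ 0ₛ
dilate-oddPow2-even s j = trans (dilate-cong (s * 2) (oddPow2-even s) j) (dilate-0ₛ (s * 2) j)

oddPow2-odd : ∀ s m → oddPow2 (suc (s * 2)) m ≡ isPow2 m
oddPow2-odd s m =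
  trans (cong (_* isPow2 m) (𝟙-yes (¬? (2 ∣? suc (s * 2))) (2∤1+n*2 s))) (+-identityʳ (isPow2 m))

-- For odd K a block of m parts K contributes the bit length of m, which telescopes as ∑_{i ≤ m} isPow2 i.
bommBlock≗oddBlock⋆oddPow2 : ∀ K → bommBlock K ≗ oddBlock K ⋆ oddPow2 K
bommBlock≗oddBlock⋆oddPow2 K m with evenOrOdd K
... | even s = trans (lhs m) (sym (trans (⋆-congʳ (oddBlock K) (oddPow2-even s) m) (⋆-zeroʳ (oddBlock K) m)))
  where
  lhs : ∀ m → bommBlock (s * 2) m ≡ 0
  lhs zero = *-zeroʳ (oddBlock (s * 2) 0)
  lhs (suc m) = cong (_* bitLength (suc m)) (oddBlock-even (s * 2) (divides s refl) (suc m))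
... | odd s = begin
    oddBlock K m * bitLength m
  ≡⟨ trans (cong (_* bitLength m) (oddBlock-odd K m (2∤1+n*2 s))) (+-identityʳ (bitLength m)) ⟩
    bitLength m
  ≡⟨ sumTo-isPow2 m ⟨
    sumTo m isPow2
  ≡⟨ sumTo-reverse m isPow2 ⟩
    sumTo m (λ i → isPow2 (m ∸ i))
  ≡⟨ sumTo-ext m (λ i → trans (cong₂ _*_ (oddBlock-odd K i (2∤1+n*2 s)) (oddPow2-odd s (m ∸ i)))
                              (+-identityʳ _)) ⟨
    (oddBlock K ⋆ oddPow2 K) m
  ∎
  where open ≡-Reasoning

-- binaryWeights N: the coefficient of x^j counts the factorizations j = K 2^e with K ≤ N odd.
binaryWeights : ℕ → Series
binaryWeights N j = sum₁ N (λ K → dilate K (oddPow2 K) j)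

𝒜≗𝒪⋆binaryWeights : ∀ k → 𝒜 k ≗ 𝒪 k ⋆ binaryWeights k
𝒜≗𝒪⋆binaryWeights zero n = trans (gf-zero oddBomm n) (sym (⋆-zeroʳ (𝒪 0) n))
𝒜≗𝒪⋆binaryWeights (suc k) n = begin
    𝒜 K n
  ≡⟨ 𝒜-step k n ⟩
    newPart + (dilate K (oddBlock K) ⋆ 𝒜 k) n
  ≡⟨ +-comm newPart _ ⟩
    (dilate K (oddBlock K) ⋆ 𝒜 k) n + newPart
  ≡⟨ cong₂ _+_ unchanged new ⟩
    (𝒪 K ⋆ binaryWeights k) n + (𝒪 K ⋆ dilate K (oddPow2 K)) n
  ≡⟨ ⋆-distribˡ-⊕ (𝒪 K) (binaryWeights k) (dilate K (oddPow2 K)) n ⟨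
    (𝒪 K ⋆ binaryWeights K) n
  ∎
  where
  open ≡-Reasoning
  K = suc k
  newPart = (dilate K (bommBlock K) ⋆ 𝒪 k) n
  unchanged : (dilate K (oddBlock K) ⋆ 𝒜 k) n ≡ (𝒪 K ⋆ binaryWeights k) n
  unchanged = begin
      (dilate K (oddBlock K) ⋆ 𝒜 k) n
    ≡⟨ ⋆-congʳ (dilate K (oddBlock K)) (𝒜≗𝒪⋆binaryWeights k) n ⟩
      (dilate K (oddBlock K) ⋆ (𝒪 k ⋆ binaryWeights k)) n
    ≡⟨ ⋆-assoc (dilate K (oddBlock K)) (𝒪 k) (binaryWeights k) n ⟨
      (dilate K (oddBlock K) ⋆ 𝒪 k ⋆ binaryWeights k) n
    ≡⟨ ⋆-congˡ (binaryWeights k) (𝒪-step k) n ⟨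
      (𝒪 K ⋆ binaryWeights k) n
    ∎
  new : newPart ≡ (𝒪 K ⋆ dilate K (oddPow2 K)) n
  new = begin
      newPart
    ≡⟨ ⋆-congˡ (𝒪 k) (dilate-cong K (bommBlock≗oddBlock⋆oddPow2 K)) n ⟩
      (dilate K (oddBlock K ⋆ oddPow2 K) ⋆ 𝒪 k) n
    ≡⟨ ⋆-congˡ (𝒪 k) (dilate-⋆-dilate K (oddBlock K) (oddPow2 K)) n ⟨
      (dilate K (oddBlock K) ⋆ dilate K (oddPow2 K) ⋆ 𝒪 k) n
    ≡⟨ ⋆-comm-right (dilate K (oddBlock K)) (dilate K (oddPow2 K)) (𝒪 k) n ⟩
      (dilate K (oddBlock K) ⋆ 𝒪 k ⋆ dilate K (oddPow2 K)) n
    ≡⟨ ⋆-congˡ (dilate K (oddPow2 K)) (𝒪-step k) n ⟨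
      (𝒪 K ⋆ dilate K (oddPow2 K)) n
    ∎

sumTo-evenOdd : ∀ t f →
  sumTo (suc (t * 2)) f ≡ sumTo t (λ i → f (i * 2)) + sumTo t (λ i → f (suc (i * 2)))
sumTo-evenOdd zero f = refl
sumTo-evenOdd (suc t) f = trans
  (cong (λ z → z + f (suc (suc (t * 2))) + f (suc (suc (suc (t * 2))))) (sumTo-evenOdd t f))
  (trans (+-assoc (sumTo t (λ i → f (i * 2)) + sumTo t (λ i → f (suc (i * 2)))) _ _)
         (+-interchange (sumTo t (λ i → f (i * 2))) _ _ _))

-- An odd j = K·m with K odd forces m odd; among odd m only m = 1 is a power of 2.
dilate-oddPow2-odd : ∀ t K → dilate K (oddPow2 K) (suc (t * 2)) ≡ 𝟙 (K ≟ suc (t * 2))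
dilate-oddPow2-odd t K with evenOrOdd K
... | even s = trans (dilate-oddPow2-even s j) (sym (𝟙-no (s * 2 ≟ j) (m*2≢1+n*2 s t)))
  where j = suc (t * 2)
... | odd s = trans (sumTo-single j 1 (s≤s z≤n) others)
                    (trans (cong₂ _*_ (cong (λ z → 𝟙 (z ≟ j)) (*-identityˡ K)) (oddPow2-odd s 1))
                           (*-identityʳ _))
  where
  j = suc (t * 2)
  others : ∀ m → m ≤ j → m ≢ 1 → 𝟙 (m * K ≟ j) * oddPow2 K m ≡ 0
  others m _ m≢1 with evenOrOdd m
  ... | even u = cong (_* oddPow2 K (u * 2))
                      (𝟙-no (u * 2 * K ≟ j) (λ e → m*2≢1+n*2 (u * K) t (trans (*-rightComm u K 2) e)))
  ... | odd zero = ⊥-elim (m≢1 refl)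
  ... | odd (suc u) = *-vanishʳ (𝟙 (suc (suc u * 2) * K ≟ j)) (trans (oddPow2-odd s (suc (suc u * 2))) (isPow2-odd u))

-- Halving j = 2t halves m in j = K·m (K odd) and keeps whether m is a power of 2.
dilate-oddPow2-double : ∀ t K → dilate K (oddPow2 K) (t * 2) ≡ dilate K (oddPow2 K) t
dilate-oddPow2-double t K with evenOrOdd K
... | even s = trans (dilate-oddPow2-even s (t * 2)) (sym (dilate-oddPow2-even s t))
... | odd s = begin
    sumTo (t * 2) f
  ≡⟨ sumTo-pad (t * 2) (suc (t * 2)) (n≤1+n _) (λ i t*2<i → cong (_* oddPow2 K i)
       (𝟙-no (i * K ≟ t * 2) (λ e → <⇒≢ (<-≤-trans t*2<i (m≤m*n i K)) (sym e)))) ⟨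
    sumTo (suc (t * 2)) f
  ≡⟨ sumTo-evenOdd t f ⟩
    sumTo t (λ i → f (i * 2)) + sumTo t (λ i → f (suc (i * 2)))
  ≡⟨ cong₂ _+_ (sumTo-ext t evens) (sumTo-zero t odds) ⟩
    dilate K (oddPow2 K) t + 0
  ≡⟨ +-identityʳ _ ⟩
    dilate K (oddPow2 K) t
  ∎
  where
  open ≡-Reasoning
  f : ℕ → ℕ
  f m = 𝟙 (m * K ≟ t * 2) * oddPow2 K m
  evens : ∀ i → f (i * 2) ≡ 𝟙 (i * K ≟ t) * oddPow2 K i
  evens i = cong₂ _*_
    (𝟙-⇔ (i * 2 * K ≟ t * 2) (i * K ≟ t) (λ e → *-cancelʳ-≡ (i * K) t 2 (trans (*-rightComm i K 2) e))
                                          (λ e → trans (*-rightComm i 2 K) (cong (_* 2) e)))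
    (trans (oddPow2-odd s (i * 2)) (trans (isPow2-double i) (sym (oddPow2-odd s i))))
  odds : ∀ i → i ≤ t → f (suc (i * 2)) ≡ 0
  odds zero _ =
    cong (_* oddPow2 K 1) (𝟙-no (1 * K ≟ t * 2) (λ e → m*2≢1+n*2 t s (sym (trans (sym (*-identityˡ K)) e))))
  odds (suc i) _ =
    *-vanishʳ (𝟙 (suc (suc i * 2) * K ≟ t * 2)) (trans (oddPow2-odd s (suc (suc i * 2))) (isPow2-odd i))

binaryWeights-positive : ∀ N j → 1 ≤ j → j ≤ N → binaryWeights N j ≡ 1
binaryWeights-positive N = <-rec (λ j → 1 ≤ j → j ≤ N → binaryWeights N j ≡ 1) step
  where
  step : ∀ j → (∀ {i} → i < j → 1 ≤ i → i ≤ N → binaryWeights N i ≡ 1) →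
         1 ≤ j → j ≤ N → binaryWeights N j ≡ 1
  step j rec 1≤j j≤N with evenOrOdd j
  ... | odd t = trans (sum₁-single _ N j 1≤j j≤N λ K _ _ K≢j → trans (dilate-oddPow2-odd t K) (𝟙-no (K ≟ j) K≢j))
                      (trans (dilate-oddPow2-odd t j) (𝟙-yes (j ≟ j) refl))
  ... | even zero = ⊥-elim (1+n≰n 1≤j)
  ... | even (suc t) = trans (sum₁-cong _ _ N (λ K _ _ → dilate-oddPow2-double (suc t) K))
                             (rec {suc t} (s≤s (s≤s (m≤m*n t 2))) (s≤s z≤n) (≤-trans (m≤m*n (suc t) 2) j≤N))

binaryWeights≈powersUpTo : ∀ N → binaryWeights N ≈[ N ] powersUpTo N
binaryWeights≈powersUpTo N zero _ =
  trans (sum₁-zero _ N (λ K _ _ → trans (+-identityʳ _) (*-zeroʳ (𝟙 (¬? (2 ∣? K))))))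
        (sym (powersUpTo-coeff N 0 z≤n))
binaryWeights≈powersUpTo N (suc j) 1+j≤N =
  trans (binaryWeights-positive N (suc j) (s≤s z≤n) 1+j≤N) (sym (powersUpTo-coeff N (suc j) 1+j≤N))

𝒜≡ℬ+𝒞 : ∀ n → 𝒜 n n ≡ ℬ n n + 𝒞 n n
𝒜≡ℬ+𝒞 n = begin
  𝒜 n n                        ≡⟨ 𝒜≗𝒪⋆binaryWeights n n ⟩
  (𝒪 n ⋆ binaryWeights n) n    ≡⟨ ⋆-cong-≈ n (λ j j≤n → sym (𝒟≈𝒪 n j j≤n)) (binaryWeights≈powersUpTo n) n ≤-refl ⟩
  (𝒟 n ⋆ powersUpTo n) n       ≡⟨ ℬ⊕𝒞≗𝒟⋆powersUpTo n n ⟨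
  ℬ n n + 𝒞 n n                ∎
  where open ≡-Reasoning

open import Data.Integer using (+_; _-_)
open import Data.Integer.Properties using ([+m]-[+n]≡m⊖n; ⊖-≥)

+[m+n]-+m≡+n : ∀ m n → + (m + n) - + m ≡ + n
+[m+n]-+m≡+n m n = trans ([+m]-[+n]≡m⊖n (m + n) m) (trans (⊖-≥ (m≤m+n m n)) (cong +_ (m+n∸m≡n m n)))

c₂≡𝒞 : ∀ n → c₂ n ≡ 𝒞 n n
c₂≡𝒞 n = begin
    length (filter oneTwiceRestOnce? (partitions n))
  ≡⟨ length-filter oneTwiceRestOnce? (partitions n) ⟩
    sum (map (λ xs → 𝟙 (oneTwiceRestOnce? xs)) (partitions n))
  ≡⟨ sum-map-cong (partitions n) (λ {xs} _ → oneTwice𝟙-correct xs) ⟩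
    sum (map oneTwice𝟙 (partitions n))
  ≡⟨ sum-map-partitions oneTwice𝟙 n ⟩
    𝒞 n n
  ∎
  where open ≡-Reasoning

bommSum≡𝒜 : ∀ n → sum (map bommTotal (oddPartitions n)) ≡ 𝒜 n n
bommSum≡𝒜 n = trans (sum-map-filter odd? bommTotal (partitions n)) (sum-map-partitions oddBomm n)

lengthSum≡ℬ : ∀ n → sum (map length (distinctPartitions n)) ≡ ℬ n n
lengthSum≡ℬ n = trans (sum-map-filter distinct? length (partitions n)) (sum-map-partitions distinctLength n)

-- The identity also holds for n = 0.
mainTheorem7 : (n : ℕ) → n ≥ 1 → + c₂ n ≡ b₂ n
mainTheorem7 n _ = begin
    + c₂ n
  ≡⟨ cong +_ (c₂≡𝒞 n) ⟩
    + 𝒞 n n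
  ≡⟨ +[m+n]-+m≡+n (ℬ n n) (𝒞 n n) ⟨
    + (ℬ n n + 𝒞 n n) - + ℬ n n
  ≡⟨ cong₂ (λ a b → + a - + b) (trans (bommSum≡𝒜 n) (𝒜≡ℬ+𝒞 n)) (lengthSum≡ℬ n) ⟨
    b₂ n
  ∎
  where open ≡-Reasoning
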